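{- Let $n=2m$ be even, and work in the group algebra $\mathbb{Q}[\mathfrak S_n]$ with product $(\sigma\tau)(i)=\sigma(\tau(i))$, identifying a permutation $\sigma$ with its word $[\sigma(1),\dots,\sigma(n)]$. Let $s_i$ be the simple transposition $(i,i+1)$. Let $$\mathrm{Pf}_n=\sum_{w}\mathrm{sgn}(w)\,w,$$ the sum over all words $w=[i_1,j_1,i_2,j_2,\dots,i_m,j_m]$ which are permutations of $1,\dots,n$ with $i_k<j_k$ for all $k$ and $j_1<j_2<\dots<j_m$. For $\pi\in\mathfrak S_m$ let $\beta_\pi\in\mathfrak S_n$ be the block permutation $\beta_\pi(2k-1)=2\pi(k)-1$, $\beta_\pi(2k)=2\pi(k)$, and let $\Theta_n=\sum_{\pi\in\mathfrak S_m}\beta_\pi$. Then $$\sum_{\sigma\in\mathfrak S_n}\mathrm{sgn}(\sigma)\,\sigma=\mathrm{Pf}_n\,\Theta_n\,(1-s_1)(1-s_3)\cdots(1-s_{n-1})=\mathrm{Pf}_n\,(1-s_1)(1-s_3)\cdots(1-s_{n-1})\,\Theta_n.$$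
   Context: $\mathrm{sgn}(\sigma)=(-1)^{\ell(\sigma)}$ denotes the sign of a permutation. With the stated product convention, right multiplication of a word by $s_i$ exchanges its entries in positions $i$ and $i+1$, and right multiplication by $\beta_\pi$ permutes the consecutive blocks of positions $\{1,2\},\{3,4\},\dots$. -}

module Defs where

open import Data.Bool using (Bool; true; false; _∧_; not; if_then_else_)
open import Data.Nat using (ℕ; zero; suc; _+_; _*_; _<ᵇ_; _≤ᵇ_; _≡ᵇ_)
open import Data.List using (List; []; _∷_; map; concatMap; upTo; filterᵇ; foldr; _++_; length)
open import Data.Product using (_×_; _,_)
open import Data.Rational using (ℚ; 0ℚ; 1ℚ; -_; _+_; _*_)
open import Relation.Binary.PropositionalEquality using (_≡_)

-- Permutations of {0,…,n-1} as words [σ(0),…,σ(n-1)] (0-based version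
-- of the paper's 1-based words; all notions below are shift-invariant).

Word : Set
Word = List ℕ

-- entry at position i (default 0, never used on valid indices)
nth : Word → ℕ → ℕ
nth []       _       = 0
nth (x ∷ _)  zero    = x
nth (_ ∷ xs) (suc i) = nth xs i

allLists : ℕ → ℕ → List Word
allLists n zero    = [] ∷ []
allLists n (suc k) = concatMap (λ x → map (x ∷_) (allLists n k)) (upTo n)

elemᵇ : ℕ → Word → Bool
elemᵇ x []       = false
elemᵇ x (y ∷ ys) = if x ≡ᵇ y then true else elemᵇ x ys

distinctᵇ : Word → Bool
distinctᵇ []       = true
distinctᵇ (x ∷ xs) = not (elemᵇ x xs) ∧ distinctᵇ xs

perms : ℕ → List Word
perms n = filterᵇ distinctᵇ (allLists n n)

compose : Word → Word → Word
compose σ τ = map (nth σ) τ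

countLess : ℕ → Word → ℕ
countLess x []       = 0
countLess x (y ∷ ys) = (if y <ᵇ x then 1 else 0) Data.Nat.+ countLess x ys

inversions : Word → ℕ
inversions []       = 0
inversions (x ∷ xs) = countLess x xs Data.Nat.+ inversions xs

negOnePow : ℕ → ℚ
negOnePow zero    = 1ℚ
negOnePow (suc k) = - negOnePow k

sgn : Word → ℚ
sgn w = negOnePow (inversions w)

-- The group algebra ℚ[S_n]: formal ℚ-linear combinations of words,
-- compared coefficientwise.

Elem : Set
Elem = List (ℚ × Word)

wordEqᵇ : Word → Word → Bool
wordEqᵇ []       []       = true
wordEqᵇ (x ∷ xs) (y ∷ ys) = (x ≡ᵇ y) ∧ wordEqᵇ xs ys
wordEqᵇ _        _        = false

coeff : Elem → Word → ℚ
coeff []             w = 0ℚ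
coeff ((c , v) ∷ xs) w = (if wordEqᵇ v w then c else 0ℚ) Data.Rational.+ coeff xs w

infix 4 _≈_
_≈_ : Elem → Elem → Set
x ≈ y = ∀ w → coeff x w ≡ coeff y w

infixl 7 _·_
_·_ : Elem → Elem → Elem
x · y = concatMap (λ { (c , v) → map (λ { (d , u) → (c Data.Rational.* d , compose v u) }) y }) x

one : ℕ → Elem
one n = (1ℚ , upTo n) ∷ []

signedSum : ℕ → Elem
signedSum n = map (λ w → (sgn w , w)) (perms n)

-- words [i₁,j₁,…,i_m,j_m] with i_k < j_k and j₁ < j₂ < … < j_m
-- (argument b: lower bound for the next j)
pfGo : ℕ → Word → Bool
pfGo b []           = true
pfGo b (_ ∷ [])     = false
pfGo b (i ∷ j ∷ r)  = (i <ᵇ j) ∧ ((b ≤ᵇ j) ∧ pfGo (suc j) r)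

pfCond : Word → Bool
pfCond = pfGo 0

Pf : ℕ → Elem
Pf n = map (λ w → (sgn w , w)) (filterᵇ pfCond (perms n))

β : Word → Word
β π = concatMap (λ p → (2 Data.Nat.* p) ∷ suc (2 Data.Nat.* p) ∷ []) π

Θ : ℕ → Elem
Θ m = map (λ π → (1ℚ , β π)) (perms m)

swapAt : ℕ → Word → Word
swapAt zero    (x ∷ y ∷ r) = y ∷ x ∷ r
swapAt zero    r           = r
swapAt (suc k) []          = []
swapAt (suc k) (x ∷ r)     = x ∷ swapAt k r

-- simple transposition exchanging 0-based positions k, k+1 (s_{k+1} in the paper)
s : ℕ → ℕ → Word
s n k = swapAt k (upTo n)

-- 1 - s_{2k+1} (paper indexing) in ℚ[S_n]
oneMinusS : ℕ → ℕ → Elem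
oneMinusS n k = (1ℚ , upTo n) ∷ (- 1ℚ , s n (2 Data.Nat.* k)) ∷ []

Y : ℕ → Elem
Y m = foldr _·_ (one (2 Data.Nat.* m)) (map (oneMinusS (2 Data.Nat.* m)) (upTo m))

-- Every term of both products is a word v carrying the coefficient sgn v: block permutations
-- β_π are even, and each factor (1 - s_{2k+1}) either keeps a word or swaps one of its blocks
-- at the price of a sign.  So it suffices to show that every permutation σ of S_n occurs
-- exactly once.  Sorting the two letters inside each block of σ and then ordering the blocks
-- by their maxima produces the unique Pfaffian word w with the same blocks; σ is obtained
-- from w by a unique block permutation π and a unique set of block flips, in either order.
module Submission where

open import Defs
open import Data.Bool using (Bool; true; false; _∧_; _∨_; if_then_else_; T)
import Data.Bool.Properties as BP
open import Data.Empty using (⊥; ⊥-elim)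
open import Data.List using (List; []; _∷_; _++_; map; concatMap; length; filterᵇ; upTo; foldr; applyUpTo; [_])
import Data.List.Properties as LP
open import Data.List.Membership.Propositional using (_∈_; _∉_)
import Data.List.Membership.Propositional.Properties as MemP
open import Data.List.Relation.Binary.Permutation.Propositional using (_↭_; refl; prep; swap; trans; ↭-sym)
import Data.List.Relation.Binary.Permutation.Propositional.Properties as PermP
open import Data.List.Relation.Unary.All as All using (All; []; _∷_)
import Data.List.Relation.Unary.All.Properties as AllP
open import Data.List.Relation.Unary.Any using (here; there)
open import Data.Nat using (ℕ; zero; suc; _+_; _*_; _<_; _≤_; _<ᵇ_; _≡ᵇ_; _≤ᵇ_; z≤n; s≤s)
import Data.Nat.Properties as NP
open import Data.Product using (_×_; _,_; proj₁; proj₂; Σ)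
open import Data.Rational as Q using (ℚ; 0ℚ; 1ℚ)
import Data.Rational.Properties as QP
open import Data.Rational.Solver using (module +-*-Solver)
open import Data.Sum using (_⊎_; inj₁; inj₂)
open import Data.Unit using (⊤; tt)
open import Relation.Binary.PropositionalEquality as Eq
  using (_≡_; _≢_; refl; sym; cong; cong₂; subst; subst₂; module ≡-Reasoning)

open import Algebra.Properties.CommutativeSemigroup NP.+-commutativeSemigroup
  using (x∙yz≈y∙xz)
open import Algebra.Properties.Group QP.+-0-group using (⁻¹-involutive)

𝟙 : Bool → ℕ
𝟙 true = 1
𝟙 false = 0

≡true⇒T : ∀ {b} → b ≡ true → T b
≡true⇒T refl = tt

≡ᵇ-sound : ∀ a b → (a ≡ᵇ b) ≡ true → a ≡ b
≡ᵇ-sound a b e = NP.≡ᵇ⇒≡ a b (≡true⇒T e)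

≡ᵇ-refl : ∀ a → (a ≡ᵇ a) ≡ true
≡ᵇ-refl zero = refl
≡ᵇ-refl (suc a) = ≡ᵇ-refl a

<ᵇ-sound : ∀ a b → (a <ᵇ b) ≡ true → a < b
<ᵇ-sound a b e = NP.<ᵇ⇒< a b (≡true⇒T e)

<ᵇ-complete : ∀ a b → a < b → (a <ᵇ b) ≡ true
<ᵇ-complete zero (suc b) _ = refl
<ᵇ-complete (suc a) (suc b) (s≤s p) = <ᵇ-complete a b p

<ᵇ-false : ∀ a b → (a <ᵇ b) ≡ false → b ≤ a
<ᵇ-false a zero e = z≤n
<ᵇ-false (suc a) (suc b) e = s≤s (<ᵇ-false a b e)

≤ᵇ-sound : ∀ a b → (a ≤ᵇ b) ≡ true → a ≤ b
≤ᵇ-sound a b e = NP.≤ᵇ⇒≤ a b (≡true⇒T e)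

≤ᵇ-complete : ∀ a b → a ≤ b → (a ≤ᵇ b) ≡ true
≤ᵇ-complete zero b _ = refl
≤ᵇ-complete (suc a) (suc b) (s≤s p) = <ᵇ-complete a (suc b) (s≤s p)

∧-trueˡ : ∀ {a b} → (a ∧ b) ≡ true → a ≡ true
∧-trueˡ {true} _ = refl

∧-trueʳ : ∀ {a b} → (a ∧ b) ≡ true → b ≡ true
∧-trueʳ {true} e = e

Bool-ext : ∀ {a b : Bool} → (a ≡ true → b ≡ true) → (b ≡ true → a ≡ true) → a ≡ b
Bool-ext {true} {true} f g = refl
Bool-ext {false} {false} f g = refl
Bool-ext {true} {false} f g with f refl
... | ()
Bool-ext {false} {true} f g with g refl
... | ()

𝟙-∧ : ∀ a b → 𝟙 (a ∧ b) ≡ 𝟙 a * 𝟙 b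
𝟙-∧ true b = sym (NP.+-identityʳ (𝟙 b))
𝟙-∧ false b = refl

𝟙-pos : ∀ {b} → 1 ≤ 𝟙 b → b ≡ true
𝟙-pos {true} _ = refl

wordEqᵇ-sound : ∀ v w → wordEqᵇ v w ≡ true → v ≡ w
wordEqᵇ-sound [] [] _ = refl
wordEqᵇ-sound (x ∷ v) (y ∷ w) e =
  cong₂ _∷_ (≡ᵇ-sound x y (∧-trueˡ {x ≡ᵇ y} e)) (wordEqᵇ-sound v w (∧-trueʳ {x ≡ᵇ y} e))

wordEqᵇ-refl : ∀ v → wordEqᵇ v v ≡ true
wordEqᵇ-refl [] = refl
wordEqᵇ-refl (x ∷ v) rewrite ≡ᵇ-refl x = wordEqᵇ-refl v

𝟙-unique : ∀ (P : Word → Bool) x x₀ → (P x ≡ true → x ≡ x₀) →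
  𝟙 (P x) ≡ 𝟙 (wordEqᵇ x x₀) * 𝟙 (P x₀)
𝟙-unique P x x₀ h with P x in e
... | true with refl ← h refl rewrite wordEqᵇ-refl x | e = refl
... | false with wordEqᵇ x x₀ in e′
...   | false = refl
...   | true with refl ← wordEqᵇ-sound x x₀ e′ rewrite e = refl

∑ : {A : Set} → (A → ℕ) → List A → ℕ
∑ f [] = 0
∑ f (x ∷ xs) = f x + ∑ f xs

∑-++ : ∀ {A : Set} (f : A → ℕ) xs ys → ∑ f (xs ++ ys) ≡ ∑ f xs + ∑ f ys
∑-++ f [] ys = refl
∑-++ f (x ∷ xs) ys rewrite ∑-++ f xs ys = sym (NP.+-assoc (f x) (∑ f xs) (∑ f ys))

∑-map : ∀ {A B : Set} (f : B → ℕ) (g : A → B) xs → ∑ f (map g xs) ≡ ∑ (λ x → f (g x)) xs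
∑-map f g [] = refl
∑-map f g (x ∷ xs) = cong (f (g x) +_) (∑-map f g xs)

∑-congᴬ : ∀ {A : Set} {f g : A → ℕ} {xs} → All (λ x → f x ≡ g x) xs → ∑ f xs ≡ ∑ g xs
∑-congᴬ [] = refl
∑-congᴬ (p ∷ ps) = cong₂ _+_ p (∑-congᴬ ps)

∑-cong : ∀ {A : Set} {f g : A → ℕ} xs → (∀ x → f x ≡ g x) → ∑ f xs ≡ ∑ g xs
∑-cong xs h = ∑-congᴬ {xs = xs} (All.tabulate λ {x} _ → h x)

∑-0 : ∀ {A : Set} (xs : List A) → ∑ (λ _ → 0) xs ≡ 0
∑-0 [] = refl
∑-0 (x ∷ xs) = ∑-0 xs

∑-*ʳ : ∀ {A : Set} (f : A → ℕ) c xs → ∑ (λ x → f x * c) xs ≡ ∑ f xs * c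
∑-*ʳ f c [] = refl
∑-*ʳ f c (x ∷ xs) rewrite ∑-*ʳ f c xs = sym (NP.*-distribʳ-+ c (f x) (∑ f xs))

∑-*ˡ : ∀ {A : Set} (f : A → ℕ) c xs → ∑ (λ x → c * f x) xs ≡ c * ∑ f xs
∑-*ˡ f c [] = sym (NP.*-zeroʳ c)
∑-*ˡ f c (x ∷ xs) rewrite ∑-*ˡ f c xs = sym (NP.*-distribˡ-+ c (f x) (∑ f xs))

∑-concatMap : ∀ {A B : Set} (f : B → ℕ) (g : A → List B) xs →
  ∑ f (concatMap g xs) ≡ ∑ (λ a → ∑ f (g a)) xs
∑-concatMap f g [] = refl
∑-concatMap f g (x ∷ xs) rewrite ∑-++ f (g x) (concatMap g xs) = cong (∑ f (g x) +_) (∑-concatMap f g xs)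

∑-filter : ∀ {A : Set} (f : A → ℕ) (p : A → Bool) xs →
  ∑ f (filterᵇ p xs) ≡ ∑ (λ x → if p x then f x else 0) xs
∑-filter f p [] = refl
∑-filter f p (x ∷ xs) with p x
... | true = cong (f x +_) (∑-filter f p xs)
... | false = ∑-filter f p xs

count : Word → List Word → ℕ
count a xs = ∑ (λ x → 𝟙 (wordEqᵇ x a)) xs

∑-pointMass : ∀ {f : Word → ℕ} (a : Word) c xs →
  All (λ x → f x ≡ 𝟙 (wordEqᵇ x a) * c) xs → ∑ f xs ≡ count a xs * c
∑-pointMass {f} a c xs h = Eq.trans (∑-congᴬ h) (∑-*ʳ (λ x → 𝟙 (wordEqᵇ x a)) c xs)

∈⇒count-pos : ∀ {x xs} → x ∈ xs → 1 ≤ count x xs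
∈⇒count-pos {x} (here refl) rewrite wordEqᵇ-refl x = s≤s z≤n
∈⇒count-pos {x} {y ∷ xs} (there m) = NP.≤-trans (∈⇒count-pos m) (NP.m≤n+m (count x xs) (𝟙 (wordEqᵇ y x)))

count-filter : ∀ (p : Word → Bool) σ xs → count σ (filterᵇ p xs) ≡ 𝟙 (p σ) * count σ xs
count-filter p σ xs =
  Eq.trans (∑-filter (λ x → 𝟙 (wordEqᵇ x σ)) p xs)
   (Eq.trans (∑-cong xs pointwise) (∑-*ˡ (λ x → 𝟙 (wordEqᵇ x σ)) (𝟙 (p σ)) xs))
  where
  pointwise : ∀ x → (if p x then 𝟙 (wordEqᵇ x σ) else 0) ≡ 𝟙 (p σ) * 𝟙 (wordEqᵇ x σ)
  pointwise x with wordEqᵇ x σ in e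
  ... | true rewrite wordEqᵇ-sound x σ e with p σ
  ...   | true = refl
  ...   | false = refl
  pointwise x | false with p x
  ... | true = sym (NP.*-zeroʳ (𝟙 (p σ)))
  ... | false = sym (NP.*-zeroʳ (𝟙 (p σ)))

nth-map : ∀ (f : ℕ → ℕ) xs i → i < length xs → nth (map f xs) i ≡ f (nth xs i)
nth-map f (x ∷ xs) zero _ = refl
nth-map f (x ∷ xs) (suc i) (s≤s p) = nth-map f xs i p

nth-All : ∀ {P : ℕ → Set} {xs} i → All P xs → i < length xs → P (nth xs i)
nth-All zero (px ∷ _) _ = px
nth-All (suc i) (_ ∷ ps) (s≤s p) = nth-All i ps p

nth-applyUpTo : ∀ (f : ℕ → ℕ) n i → i < n → nth (applyUpTo f n) i ≡ f i
nth-applyUpTo f (suc n) zero _ = refl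
nth-applyUpTo f (suc n) (suc i) (s≤s p) = nth-applyUpTo (λ x → f (suc x)) n i p

nth-upTo : ∀ n i → i < n → nth (upTo n) i ≡ i
nth-upTo = nth-applyUpTo (λ x → x)

All<-upTo : ∀ n → All (_< n) (upTo n)
All<-upTo n = AllP.applyUpTo⁺₁ (λ x → x) n (λ p → p)

compose-assoc : ∀ u a t → All (_< length a) t →
  compose (compose u a) t ≡ compose u (compose a t)
compose-assoc u a t h =
  Eq.trans (LP.map-cong-local (All.map (λ {i} p → nth-map (nth u) a i p) h)) (LP.map-∘ t)

compose-identityʳ : ∀ u n → length u ≡ n → compose u (upTo n) ≡ u
compose-identityʳ u _ refl = go u
  where
  go : ∀ u → compose u (upTo (length u)) ≡ u
  go [] = refl
  go (x ∷ u) = cong (x ∷_) (Eq.trans (LP.map-applyUpTo suc (nth (x ∷ u)) (length u))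
                                     (Eq.trans (sym (LP.map-upTo (nth u) (length u))) (go u)))

compose-identityˡ : ∀ n t → All (_< n) t → compose (upTo n) t ≡ t
compose-identityˡ n t h = Eq.trans (LP.map-cong-local (All.map (λ {i} p → nth-upTo n i p) h)) (LP.map-id t)

All<-compose : ∀ n a t → All (_< length a) t → All (_< n) a → All (_< n) (compose a t)
All<-compose n a t h ha = AllP.map⁺ (All.map (λ {i} p → nth-All i ha p) h)

map-swapAt : ∀ (f : ℕ → ℕ) k l → map f (swapAt k l) ≡ swapAt k (map f l)
map-swapAt f zero [] = refl
map-swapAt f zero (x ∷ []) = refl
map-swapAt f zero (x ∷ y ∷ l) = refl
map-swapAt f (suc k) [] = refl
map-swapAt f (suc k) (x ∷ l) = cong (f x ∷_) (map-swapAt f k l)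

swapAt-↭ : ∀ k (l : List ℕ) → swapAt k l ↭ l
swapAt-↭ zero [] = refl
swapAt-↭ zero (x ∷ []) = refl
swapAt-↭ zero (x ∷ y ∷ l) = swap y x refl
swapAt-↭ (suc k) [] = refl
swapAt-↭ (suc k) (x ∷ l) = prep x (swapAt-↭ k l)

length-swapAt : ∀ k (l : List ℕ) → length (swapAt k l) ≡ length l
length-swapAt k l = PermP.↭-length (swapAt-↭ k l)

compose-s : ∀ u n k → length u ≡ n → compose u (s n k) ≡ swapAt k u
compose-s u n k e = Eq.trans (map-swapAt (nth u) k (upTo n)) (cong (swapAt k) (compose-identityʳ u n e))

length-s : ∀ n k → length (s n k) ≡ n
length-s n k = Eq.trans (length-swapAt k (upTo n)) (LP.length-upTo n)

All<-s : ∀ n k → All (_< n) (s n k)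
All<-s n k = PermP.All-resp-↭ (↭-sym (swapAt-↭ k (upTo n))) (All<-upTo n)

data Distinct {A : Set} : List A → Set where
  [] : Distinct []
  _∷_ : ∀ {x xs} → x ∉ xs → Distinct xs → Distinct (x ∷ xs)

Distinct-resp-↭ : ∀ {A : Set} {xs ys : List A} → xs ↭ ys → Distinct xs → Distinct ys
Distinct-resp-↭ refl d = d
Distinct-resp-↭ (prep x p) (nx ∷ d) = (λ m → nx (PermP.∈-resp-↭ (↭-sym p) m)) ∷ Distinct-resp-↭ p d
Distinct-resp-↭ (swap x y p) (nx ∷ (ny ∷ d)) =
  (λ { (here e) → nx (here (sym e)) ; (there m) → ny (PermP.∈-resp-↭ (↭-sym p) m) })
  ∷ ((λ m → nx (there (PermP.∈-resp-↭ (↭-sym p) m))) ∷ Distinct-resp-↭ p d)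
Distinct-resp-↭ (trans p q) d = Distinct-resp-↭ q (Distinct-resp-↭ p d)

Distinct-head-≢ : ∀ {A : Set} {x y : A} {xs} → Distinct (x ∷ y ∷ xs) → x ≢ y
Distinct-head-≢ (nx ∷ _) e = nx (here e)

Distinct-remove : ∀ {A : Set} (xs ys : List A) v → Distinct (xs ++ v ∷ ys) → v ∉ xs ++ ys × Distinct (xs ++ ys)
Distinct-remove xs ys v d with Distinct-resp-↭ (PermP.shift v xs ys) d
... | nv ∷ d' = nv , d'

Distinct-map-injective : ∀ {A B : Set} (f : A → B) {L : List A} →
  (∀ {a b} → a ∈ L → b ∈ L → f a ≡ f b → a ≡ b) → Distinct L → Distinct (map f L)
Distinct-map-injective f {[]} inj d = []
Distinct-map-injective f {x ∷ L} inj (nx ∷ d) =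
  (λ m → nx (back m)) ∷ Distinct-map-injective f (λ a b → inj (there a) (there b)) d
  where
  back : f x ∈ map f L → x ∈ L
  back m with MemP.∈-map⁻ f m
  ... | y , ym , eq = subst (_∈ L) (sym (inj (here refl) (there ym) eq)) ym

elemᵇ-sound : ∀ x xs → elemᵇ x xs ≡ true → x ∈ xs
elemᵇ-sound x (y ∷ xs) e with x ≡ᵇ y in exy
... | true = here (≡ᵇ-sound x y exy)
... | false = there (elemᵇ-sound x xs e)

elemᵇ-false : ∀ x xs → elemᵇ x xs ≡ false → x ∉ xs
elemᵇ-false x (y ∷ xs) e m with x ≡ᵇ y in exy
elemᵇ-false x (y ∷ xs) () m | true
elemᵇ-false x (y ∷ xs) e (here refl) | false with () ← Eq.trans (sym (≡ᵇ-refl x)) exy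
elemᵇ-false x (y ∷ xs) e (there m) | false = elemᵇ-false x xs e m

distinctᵇ-sound : ∀ xs → distinctᵇ xs ≡ true → Distinct xs
distinctᵇ-sound [] _ = []
distinctᵇ-sound (x ∷ xs) e with elemᵇ x xs in ex
... | false = elemᵇ-false x xs ex ∷ distinctᵇ-sound xs e

distinctᵇ-complete : ∀ {xs} → Distinct xs → distinctᵇ xs ≡ true
distinctᵇ-complete [] = refl
distinctᵇ-complete {x ∷ xs} (nx ∷ d) with elemᵇ x xs in ex
... | true = ⊥-elim (nx (elemᵇ-sound x xs ex))
... | false = distinctᵇ-complete d

hasLengthᵇ : Word → ℕ → Bool
hasLengthᵇ [] zero = true
hasLengthᵇ (x ∷ xs) (suc k) = hasLengthᵇ xs k
hasLengthᵇ _ _ = false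

allBelowᵇ : ℕ → Word → Bool
allBelowᵇ n [] = true
allBelowᵇ n (x ∷ xs) = (x <ᵇ n) ∧ allBelowᵇ n xs

isPermᵇ : ℕ → Word → Bool
isPermᵇ n σ = (hasLengthᵇ σ n ∧ allBelowᵇ n σ) ∧ distinctᵇ σ

∑-upTo-≡ᵇ : ∀ y n → ∑ (λ x → 𝟙 (x ≡ᵇ y)) (upTo n) ≡ 𝟙 (y <ᵇ n)
∑-upTo-≡ᵇ y zero = refl
∑-upTo-≡ᵇ y (suc n) =
  Eq.trans (cong (∑ (λ x → 𝟙 (x ≡ᵇ y))) (sym (LP.upTo-∷ʳ n)))
  (Eq.trans (∑-++ (λ x → 𝟙 (x ≡ᵇ y)) (upTo n) [ n ])
  (Eq.trans (cong₂ _+_ (∑-upTo-≡ᵇ y n) (NP.+-identityʳ (𝟙 (n ≡ᵇ y)))) (step y n)))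
  where
  step : ∀ y n → 𝟙 (y <ᵇ n) + 𝟙 (n ≡ᵇ y) ≡ 𝟙 (y <ᵇ suc n)
  step zero zero = refl
  step zero (suc n) = refl
  step (suc y) zero = refl
  step (suc y) (suc n) = step y n

count-allLists : ∀ n k σ → count σ (allLists n k) ≡ 𝟙 (hasLengthᵇ σ k ∧ allBelowᵇ n σ)
count-allLists n zero [] = refl
count-allLists n zero (x ∷ σ) = refl
count-allLists n (suc k) σ =
  begin
    count σ (allLists n (suc k))
  ≡⟨ ∑-concatMap (λ x → 𝟙 (wordEqᵇ x σ)) (λ x → map (x ∷_) (allLists n k)) (upTo n) ⟩
    ∑ (λ x → ∑ (λ v → 𝟙 (wordEqᵇ v σ)) (map (x ∷_) (allLists n k))) (upTo n)
  ≡⟨ ∑-cong (upTo n) (λ x → ∑-map (λ v → 𝟙 (wordEqᵇ v σ)) (x ∷_) (allLists n k)) ⟩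
    ∑ (λ x → ∑ (λ ys → 𝟙 (wordEqᵇ (x ∷ ys) σ)) (allLists n k)) (upTo n)
  ≡⟨ byHead σ ⟩
    𝟙 (hasLengthᵇ σ (suc k) ∧ allBelowᵇ n σ)
  ∎
  where
  open ≡-Reasoning
  byHead : ∀ σ → ∑ (λ x → ∑ (λ ys → 𝟙 (wordEqᵇ (x ∷ ys) σ)) (allLists n k)) (upTo n)
                 ≡ 𝟙 (hasLengthᵇ σ (suc k) ∧ allBelowᵇ n σ)
  byHead [] = Eq.trans (∑-cong (upTo n) (λ x → ∑-0 (allLists n k))) (∑-0 (upTo n))
  byHead (y ∷ σ') =
    begin
      ∑ (λ x → ∑ (λ ys → 𝟙 ((x ≡ᵇ y) ∧ wordEqᵇ ys σ')) (allLists n k)) (upTo n)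
    ≡⟨ ∑-cong (upTo n) (λ x → Eq.trans (∑-cong (allLists n k) (λ ys → 𝟙-∧ (x ≡ᵇ y) (wordEqᵇ ys σ')))
                                         (∑-*ˡ (λ ys → 𝟙 (wordEqᵇ ys σ')) (𝟙 (x ≡ᵇ y)) (allLists n k))) ⟩
      ∑ (λ x → 𝟙 (x ≡ᵇ y) * count σ' (allLists n k)) (upTo n)
    ≡⟨ ∑-*ʳ (λ x → 𝟙 (x ≡ᵇ y)) (count σ' (allLists n k)) (upTo n) ⟩
      ∑ (λ x → 𝟙 (x ≡ᵇ y)) (upTo n) * count σ' (allLists n k)
    ≡⟨ cong₂ _*_ (∑-upTo-≡ᵇ y n) (count-allLists n k σ') ⟩
      𝟙 (y <ᵇ n) * 𝟙 (hasLengthᵇ σ' k ∧ allBelowᵇ n σ')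
    ≡⟨ regroup (y <ᵇ n) (hasLengthᵇ σ' k) (allBelowᵇ n σ') ⟩
      𝟙 (hasLengthᵇ σ' k ∧ ((y <ᵇ n) ∧ allBelowᵇ n σ'))
    ∎
    where
    regroup : ∀ a b c → 𝟙 a * 𝟙 (b ∧ c) ≡ 𝟙 (b ∧ (a ∧ c))
    regroup true true true = refl
    regroup true true false = refl
    regroup true false c = refl
    regroup false true c = refl
    regroup false false c = refl

count-perms : ∀ n σ → count σ (perms n) ≡ 𝟙 (isPermᵇ n σ)
count-perms n σ =
  begin
    count σ (perms n)
  ≡⟨ count-filter distinctᵇ σ (allLists n n) ⟩
    𝟙 (distinctᵇ σ) * count σ (allLists n n)
  ≡⟨ cong (𝟙 (distinctᵇ σ) *_) (count-allLists n n σ) ⟩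
    𝟙 (distinctᵇ σ) * 𝟙 (hasLengthᵇ σ n ∧ allBelowᵇ n σ)
  ≡⟨ NP.*-comm (𝟙 (distinctᵇ σ)) _ ⟩
    𝟙 (hasLengthᵇ σ n ∧ allBelowᵇ n σ) * 𝟙 (distinctᵇ σ)
  ≡⟨ sym (𝟙-∧ (hasLengthᵇ σ n ∧ allBelowᵇ n σ) (distinctᵇ σ)) ⟩
    𝟙 (isPermᵇ n σ)
  ∎
  where open ≡-Reasoning

∈perms⇒isPermᵇ : ∀ {n x} → x ∈ perms n → isPermᵇ n x ≡ true
∈perms⇒isPermᵇ {n} {x} m = 𝟙-pos (subst (1 ≤_) (count-perms n x) (∈⇒count-pos m))

record IsPerm (n : ℕ) (σ : Word) : Set where
  constructor mkIsPerm
  field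
    length≡  : length σ ≡ n
    below    : All (_< n) σ
    distinct : Distinct σ

hasLengthᵇ-sound : ∀ σ n → hasLengthᵇ σ n ≡ true → length σ ≡ n
hasLengthᵇ-sound [] zero _ = refl
hasLengthᵇ-sound (x ∷ σ) (suc n) e = cong suc (hasLengthᵇ-sound σ n e)

hasLengthᵇ-complete : ∀ σ → hasLengthᵇ σ (length σ) ≡ true
hasLengthᵇ-complete [] = refl
hasLengthᵇ-complete (x ∷ σ) = hasLengthᵇ-complete σ

allBelowᵇ-sound : ∀ n σ → allBelowᵇ n σ ≡ true → All (_< n) σ
allBelowᵇ-sound n [] _ = []
allBelowᵇ-sound n (x ∷ σ) e =
  <ᵇ-sound x n (∧-trueˡ {x <ᵇ n} e) ∷ allBelowᵇ-sound n σ (∧-trueʳ {x <ᵇ n} e)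

allBelowᵇ-complete : ∀ {n σ} → All (_< n) σ → allBelowᵇ n σ ≡ true
allBelowᵇ-complete [] = refl
allBelowᵇ-complete {n} {x ∷ σ} (p ∷ ps) rewrite <ᵇ-complete x n p = allBelowᵇ-complete ps

isPermᵇ-sound : ∀ n σ → isPermᵇ n σ ≡ true → IsPerm n σ
isPermᵇ-sound n σ e =
  mkIsPerm (hasLengthᵇ-sound σ n (∧-trueˡ {hasLengthᵇ σ n} shape))
           (allBelowᵇ-sound n σ (∧-trueʳ {hasLengthᵇ σ n} shape))
           (distinctᵇ-sound σ (∧-trueʳ {hasLengthᵇ σ n ∧ allBelowᵇ n σ} e))
  where shape = ∧-trueˡ {hasLengthᵇ σ n ∧ allBelowᵇ n σ} e

isPermᵇ-complete : ∀ {n σ} → IsPerm n σ → isPermᵇ n σ ≡ true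
isPermᵇ-complete {n} {σ} (mkIsPerm refl l d)
  rewrite hasLengthᵇ-complete σ | allBelowᵇ-complete l = distinctᵇ-complete d

∈perms⇒IsPerm : ∀ {n x} → x ∈ perms n → IsPerm n x
∈perms⇒IsPerm {n} {x} m = isPermᵇ-sound n x (∈perms⇒isPermᵇ m)

IsPerm-resp-↭ : ∀ {n σ τ} → σ ↭ τ → IsPerm n σ → IsPerm n τ
IsPerm-resp-↭ p (mkIsPerm l a d) =
  mkIsPerm (Eq.trans (sym (PermP.↭-length p)) l) (PermP.All-resp-↭ p a) (Distinct-resp-↭ p d)

All<-shrink : ∀ {k : ℕ} {xs} → All (_< suc k) xs → k ∉ xs → All (_< k) xs
All<-shrink {k} h n = All.zipWith (λ (p , q) → NP.≤∧≢⇒< (NP.≤-pred p) q) (h , ≢k n)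
  where
  ≢k : ∀ {xs} → k ∉ xs → All (_≢ k) xs
  ≢k {[]} _ = []
  ≢k {x ∷ xs} n = (λ e → n (here (sym e))) ∷ ≢k (λ m → n (there m))

Distinct-length-≤ : ∀ k (π : Word) → Distinct π → All (_< k) π → length π ≤ k
Distinct-length-≤ zero [] d h = z≤n
Distinct-length-≤ zero (x ∷ π) d (() ∷ h)
Distinct-length-≤ (suc k) π d h with elemᵇ k π in e
... | false = NP.m≤n⇒m≤1+n (Distinct-length-≤ k π d (All<-shrink h (elemᵇ-false k π e)))
... | true with MemP.∈-∃++ (elemᵇ-sound k π e)
...   | xs , ys , refl with Distinct-remove xs ys k d
...     | k∉ , d' = subst (_≤ suc k) (sym (PermP.↭-length (PermP.shift k xs ys)))
                      (s≤s (Distinct-length-≤ k (xs ++ ys) d'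
                             (All<-shrink (All.tail (PermP.All-resp-↭ (PermP.shift k xs ys) h)) k∉)))

IsPerm⇒↭upTo : ∀ m π → IsPerm m π → π ↭ upTo m
IsPerm⇒↭upTo zero [] v = refl
IsPerm⇒↭upTo (suc m) π (mkIsPerm l h d) with elemᵇ m π in e
... | false =
  ⊥-elim (NP.<-irrefl refl (subst (_≤ m) l (Distinct-length-≤ m π d (All<-shrink h (elemᵇ-false m π e)))))
... | true with MemP.∈-∃++ (elemᵇ-sound m π e)
...   | xs , ys , refl with Distinct-remove xs ys m d
...     | m∉ , d' = trans (PermP.shift m xs ys)
                    (trans (prep m (IsPerm⇒↭upTo m (xs ++ ys) (mkIsPerm l' (All<-shrink h' m∉) d')))
                    (↭-sym upTo-suc-↭))
  where
  l' : length (xs ++ ys) ≡ m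
  l' = NP.suc-injective (Eq.trans (sym (PermP.↭-length (PermP.shift m xs ys))) l)
  h' : All (_< suc m) (xs ++ ys)
  h' = All.tail (PermP.All-resp-↭ (PermP.shift m xs ys) h)
  upTo-suc-↭ : upTo (suc m) ↭ m ∷ upTo m
  upTo-suc-↭ = subst (_↭ m ∷ upTo m) (LP.upTo-∷ʳ m)
    (subst (λ z → upTo m ++ [ m ] ↭ m ∷ z) (LP.++-identityʳ (upTo m)) (PermP.shift m (upTo m) []))

∑-· : ∀ (f : ℚ × Word → ℕ) x y →
  ∑ f (x · y) ≡ ∑ (λ a → ∑ (λ b → f (proj₁ a Q.* proj₁ b , compose (proj₂ a) (proj₂ b))) y) x
∑-· f x y = Eq.trans (∑-concatMap f _ x) (∑-cong x (λ a → ∑-map f _ y))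

All-· : ∀ {R : ℚ × Word → Set} x y →
  All (λ a → All (λ b → R (proj₁ a Q.* proj₁ b , compose (proj₂ a) (proj₂ b))) y) x → All R (x · y)
All-· [] y [] = []
All-· ((c , v) ∷ x) y (h ∷ hs) = AllP.++⁺ (AllP.map⁺ h) (All-· x y hs)

-- Sign

negOnePow-+ : ∀ a b → negOnePow (a + b) ≡ negOnePow a Q.* negOnePow b
negOnePow-+ zero b = sym (QP.*-identityˡ (negOnePow b))
negOnePow-+ (suc a) b rewrite negOnePow-+ a b = QP.neg-distribˡ-* (negOnePow a) (negOnePow b)

sgn-∷ : ∀ x xs → sgn (x ∷ xs) ≡ negOnePow (countLess x xs) Q.* sgn xs
sgn-∷ x xs = negOnePow-+ (countLess x xs) (inversions xs)

countLess-↭ : ∀ x {xs ys} → xs ↭ ys → countLess x xs ≡ countLess x ys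
countLess-↭ x refl = refl
countLess-↭ x (prep y p) = cong (_ +_) (countLess-↭ x p)
countLess-↭ x {_} {z ∷ y ∷ ys} (swap y z p) rewrite countLess-↭ x p =
  x∙yz≈y∙xz (if y <ᵇ x then 1 else 0) (if z <ᵇ x then 1 else 0) (countLess x ys)
countLess-↭ x (trans p q) = Eq.trans (countLess-↭ x p) (countLess-↭ x q)

sgn-swapHead : ∀ x y r → x ≢ y → sgn (y ∷ x ∷ r) ≡ Q.- sgn (x ∷ y ∷ r)
sgn-swapHead x y r x≢y with y <ᵇ x in e1 | x <ᵇ y in e2
... | true | true = ⊥-elim (NP.<-asym (<ᵇ-sound y x e1) (<ᵇ-sound x y e2))
... | false | false = ⊥-elim (x≢y (NP.≤-antisym (<ᵇ-false y x e1) (<ᵇ-false x y e2)))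
... | true | false =
  Eq.trans (cong negOnePow (x∙yz≈y∙xz (countLess y r) (countLess x r) (inversions r))) (sym (⁻¹-involutive _))
... | false | true =
  cong (λ z → Q.- negOnePow z) (x∙yz≈y∙xz (countLess y r) (countLess x r) (inversions r))

sgn-swapAt : ∀ k u → suc k < length u → Distinct u → sgn (swapAt k u) ≡ Q.- sgn u
sgn-swapAt zero (x ∷ y ∷ r) _ d = sgn-swapHead x y r (Distinct-head-≢ d)
sgn-swapAt zero (x ∷ []) (s≤s ()) d
sgn-swapAt (suc k) (z ∷ u) (s≤s p) (_ ∷ d) =
  begin
    sgn (z ∷ swapAt k u)
  ≡⟨ sgn-∷ z (swapAt k u) ⟩
    negOnePow (countLess z (swapAt k u)) Q.* sgn (swapAt k u)
  ≡⟨ cong₂ (λ a b → negOnePow a Q.* b) (countLess-↭ z (swapAt-↭ k u)) (sgn-swapAt k u p d) ⟩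
    negOnePow (countLess z u) Q.* Q.- sgn u
  ≡⟨ sym (QP.neg-distribʳ-* (negOnePow (countLess z u)) (sgn u)) ⟩
    Q.- (negOnePow (countLess z u) Q.* sgn u)
  ≡⟨ cong Q.-_ (sym (sgn-∷ z u)) ⟩
    Q.- sgn (z ∷ u)
  ∎
  where open ≡-Reasoning

sgn-swapAt-swapAt : ∀ i j u → suc i < length u → suc j < length u → Distinct u →
  sgn (swapAt i (swapAt j u)) ≡ sgn u
sgn-swapAt-swapAt i j u i< j< d =
  begin
    sgn (swapAt i (swapAt j u))
  ≡⟨ sgn-swapAt i (swapAt j u) (subst (suc i <_) (sym (length-swapAt j u)) i<)
                               (Distinct-resp-↭ (↭-sym (swapAt-↭ j u)) d) ⟩
    Q.- sgn (swapAt j u)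
  ≡⟨ cong Q.-_ (sgn-swapAt j u j< d) ⟩
    Q.- (Q.- sgn u)
  ≡⟨ ⁻¹-involutive (sgn u) ⟩
    sgn u
  ∎
  where open ≡-Reasoning

sgn-++ˡ : ∀ pre {L L'} → L ↭ L' → sgn L ≡ sgn L' → sgn (pre ++ L) ≡ sgn (pre ++ L')
sgn-++ˡ [] p e = e
sgn-++ˡ (x ∷ pre) {L} {L'} p e =
  Eq.trans (sgn-∷ x (pre ++ L))
   (Eq.trans (cong₂ (λ a b → negOnePow a Q.* b) (countLess-↭ x (PermP.++⁺ˡ pre p)) (sgn-++ˡ pre p e))
    (sym (sgn-∷ x (pre ++ L'))))

-- Words as sequences of blocks

Block : Set
Block = ℕ × ℕ

blocks : Word → List Block
blocks (a ∷ b ∷ r) = (a , b) ∷ blocks r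
blocks _ = []

flat : List Block → Word
flat [] = []
flat ((a , b) ∷ B) = a ∷ b ∷ flat B

blockAt : List Block → ℕ → Block
blockAt [] _ = (0 , 0)
blockAt (x ∷ B) zero = x
blockAt (x ∷ B) (suc i) = blockAt B i

blocks-flat : ∀ B → blocks (flat B) ≡ B
blocks-flat [] = refl
blocks-flat ((a , b) ∷ B) = cong ((a , b) ∷_) (blocks-flat B)

*-2-suc : ∀ p → 2 * suc p ≡ suc (suc (2 * p))
*-2-suc p = NP.*-suc 2 p

length-dropPair : ∀ {a b : ℕ} {r} m → length (a ∷ b ∷ r) ≡ 2 * suc m → length r ≡ 2 * m
length-dropPair m e = NP.suc-injective (NP.suc-injective (Eq.trans e (*-2-suc m)))

flat-blocks : ∀ m x → length x ≡ 2 * m → flat (blocks x) ≡ x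
flat-blocks zero [] e = refl
flat-blocks (suc m) [] e with () ← Eq.trans e (*-2-suc m)
flat-blocks (suc m) (a ∷ []) e with () ← NP.suc-injective (Eq.trans e (*-2-suc m))
flat-blocks (suc m) (a ∷ b ∷ r) e = cong (λ z → a ∷ b ∷ z) (flat-blocks m r (length-dropPair {a} {b} {r} m e))

length-blocks : ∀ m x → length x ≡ 2 * m → length (blocks x) ≡ m
length-blocks zero [] e = refl
length-blocks (suc m) [] e with () ← Eq.trans e (*-2-suc m)
length-blocks (suc m) (a ∷ []) e with () ← NP.suc-injective (Eq.trans e (*-2-suc m))
length-blocks (suc m) (a ∷ b ∷ r) e = cong suc (length-blocks m r (length-dropPair {a} {b} {r} m e))

length-flat : ∀ B → length (flat B) ≡ 2 * length B
length-flat [] = refl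
length-flat ((a , b) ∷ B) rewrite length-flat B = sym (*-2-suc (length B))

nth-flat₁ : ∀ B p → nth (flat B) (2 * p) ≡ proj₁ (blockAt B p)
nth-flat₁ [] p = refl
nth-flat₁ ((a , b) ∷ B) zero = refl
nth-flat₁ ((a , b) ∷ B) (suc p) =
  subst (λ z → nth (flat ((a , b) ∷ B)) z ≡ proj₁ (blockAt B p)) (sym (*-2-suc p)) (nth-flat₁ B p)

nth-flat₂ : ∀ B p → nth (flat B) (suc (2 * p)) ≡ proj₂ (blockAt B p)
nth-flat₂ [] p = refl
nth-flat₂ ((a , b) ∷ B) zero = refl
nth-flat₂ ((a , b) ∷ B) (suc p) =
  subst (λ z → nth (flat ((a , b) ∷ B)) (suc z) ≡ proj₂ (blockAt B p)) (sym (*-2-suc p)) (nth-flat₂ B p)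

compose-flat-β : ∀ B π → compose (flat B) (β π) ≡ flat (map (blockAt B) π)
compose-flat-β B [] = refl
compose-flat-β B (p ∷ π) rewrite nth-flat₁ B p | nth-flat₂ B p = cong (λ z → _ ∷ _ ∷ z) (compose-flat-β B π)

flat-↭ : ∀ {B C} → B ↭ C → flat B ↭ flat C
flat-↭ refl = refl
flat-↭ (prep (a , b) p) = prep a (prep b (flat-↭ p))
flat-↭ {(a , b) ∷ (c , d) ∷ B} {(c , d) ∷ (a , b) ∷ C} (swap (a , b) (c , d) p) =
  trans (prep a (swap b c refl)) (trans (swap a c refl) (trans (prep c (prep a (swap b d refl)))
    (trans (prep c (swap a d refl)) (prep c (prep d (prep a (prep b (flat-↭ p))))))))
flat-↭ (trans p q) = trans (flat-↭ p) (flat-↭ q)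

-- Exchanging two blocks is a product of four adjacent transpositions, hence even.
sgn-flat-↭ : ∀ {B C} → B ↭ C → Distinct (flat B) → sgn (flat B) ≡ sgn (flat C)
sgn-flat-↭ refl d = refl
sgn-flat-↭ (prep (a , b) p) (_ ∷ (_ ∷ d)) = sgn-++ˡ (a ∷ b ∷ []) (flat-↭ p) (sgn-flat-↭ p d)
sgn-flat-↭ {(a , b) ∷ (c , d) ∷ B} {(c , d) ∷ (a , b) ∷ C} (swap _ _ p) dist@(_ ∷ _ ∷ _ ∷ _ ∷ dB) =
  begin
    sgn (a ∷ b ∷ c ∷ d ∷ flat B)
  ≡⟨ sgn-++ˡ (a ∷ b ∷ c ∷ d ∷ []) (flat-↭ p) (sgn-flat-↭ p dB) ⟩
    sgn w
  ≡⟨ sym (sgn-swapAt-swapAt 0 1 w (s≤s (s≤s z≤n)) (s≤s (s≤s (s≤s z≤n))) dw) ⟩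
    sgn w′
  ≡⟨ sym (sgn-swapAt-swapAt 1 2 w′ (s≤s (s≤s (s≤s z≤n))) (s≤s (s≤s (s≤s (s≤s z≤n)))) dw′) ⟩
    sgn (c ∷ d ∷ a ∷ b ∷ flat C)
  ∎
  where
  open ≡-Reasoning
  w = a ∷ b ∷ c ∷ d ∷ flat C
  w′ = c ∷ a ∷ b ∷ d ∷ flat C
  dw : Distinct w
  dw = Distinct-resp-↭ (PermP.++⁺ˡ (a ∷ b ∷ c ∷ d ∷ []) (flat-↭ p)) dist
  dw′ : Distinct w′
  dw′ = Distinct-resp-↭ (trans (↭-sym (swapAt-↭ 1 w)) (↭-sym (swapAt-↭ 0 (swapAt 1 w)))) dw
sgn-flat-↭ (trans p q) d = Eq.trans (sgn-flat-↭ p d) (sgn-flat-↭ q (Distinct-resp-↭ (flat-↭ p) d))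

∈-flat₁ : ∀ {a b} B → (a , b) ∈ B → a ∈ flat B
∈-flat₁ ((a , b) ∷ B) (here refl) = here refl
∈-flat₁ ((c , d) ∷ B) (there m) = there (there (∈-flat₁ B m))

∈-flat₂ : ∀ {a b} B → (a , b) ∈ B → b ∈ flat B
∈-flat₂ ((a , b) ∷ B) (here refl) = there (here refl)
∈-flat₂ ((c , d) ∷ B) (there m) = there (there (∈-flat₂ B m))

Distinct-blocks : ∀ B → Distinct (flat B) → Distinct B
Distinct-blocks [] d = []
Distinct-blocks ((a , b) ∷ B) (na ∷ (nb ∷ d)) = (λ m → na (there (∈-flat₁ B m))) ∷ Distinct-blocks B d

Distinct-blocks-≢ : ∀ B → Distinct (flat B) → All (λ z → proj₁ z ≢ proj₂ z) B
Distinct-blocks-≢ [] _ = []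
Distinct-blocks-≢ ((a , b) ∷ B) d@(_ ∷ (_ ∷ d')) = Distinct-head-≢ d ∷ Distinct-blocks-≢ B d'

Distinct-noTwins : ∀ C a b → Distinct (flat C) → (a , b) ∈ C → (b , a) ∈ C → a ≡ b
Distinct-noTwins ((c , d) ∷ C) a b dist (here refl) (here e) = cong proj₂ e
Distinct-noTwins ((c , d) ∷ C) a b (_ ∷ (nd ∷ _)) (here refl) (there m) = ⊥-elim (nd (∈-flat₁ C m))
Distinct-noTwins ((c , d) ∷ C) a b (_ ∷ (nd ∷ _)) (there m) (here refl) = ⊥-elim (nd (∈-flat₁ C m))
Distinct-noTwins ((c , d) ∷ C) a b (_ ∷ (_ ∷ dist)) (there m) (there m') = Distinct-noTwins C a b dist m m'

-- Expanding (1 - s₁)(1 - s₃)⋯(1 - s_{n-1})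

∏oneMinusS : ℕ → List ℕ → Elem
∏oneMinusS n ks = foldr _·_ (one n) (map (oneMinusS n) ks)

compose-s-assoc : ∀ u n k t → length u ≡ n → All (_< n) t →
  compose u (compose (s n k) t) ≡ compose (swapAt k u) t
compose-s-assoc u n k t e h =
  Eq.trans (sym (compose-assoc u (s n k) t (subst (λ z → All (_< z) t) (sym (length-s n k)) h)))
           (cong (λ z → compose z t) (compose-s u n k e))

∏oneMinusS-below : ∀ n ks → All (λ e → All (_< n) (proj₂ e)) (∏oneMinusS n ks)
∏oneMinusS-below n [] = All<-upTo n ∷ []
∏oneMinusS-below n (k ∷ ks) = All-· (oneMinusS n k) (∏oneMinusS n ks)
  ( All.map (λ {e} h → All<-compose n (upTo n) (proj₂ e) (below (upTo n) (LP.length-upTo n) h) (All<-upTo n))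
            (∏oneMinusS-below n ks)
  ∷ All.map (λ {e} h → All<-compose n (s n (2 * k)) (proj₂ e) (below (s n (2 * k)) (length-s n (2 * k)) h)
                                   (All<-s n (2 * k)))
            (∏oneMinusS-below n ks)
  ∷ [])
  where
  below : ∀ {t} a → length a ≡ n → All (_< n) t → All (_< length a) t
  below {t} a e = subst (λ z → All (_< z) t) (sym e)

∏oneMinusS-↭ : ∀ n ks → All (λ e → ∀ u → length u ≡ n → compose u (proj₂ e) ↭ u) (∏oneMinusS n ks)
∏oneMinusS-↭ n [] = (λ u e → subst (_↭ u) (sym (compose-identityʳ u n e)) refl) ∷ []
∏oneMinusS-↭ n (k ∷ ks) =
  All-· {λ e → ∀ u → length u ≡ n → compose u (proj₂ e) ↭ u} (oneMinusS n k) (∏oneMinusS n ks)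
  ( All.map (λ {b} (h , h') u e → subst (_↭ u) (cong (compose u) (sym (compose-identityˡ n (proj₂ b) h'))) (h u e))
      (All.zip (∏oneMinusS-↭ n ks , ∏oneMinusS-below n ks))
  ∷ All.map (λ {b} (h , h') u e →
        subst (_↭ u) (sym (compose-s-assoc u n (2 * k) (proj₂ b) e h'))
          (trans (h (swapAt (2 * k) u) (Eq.trans (length-swapAt (2 * k) u) e)) (swapAt-↭ (2 * k) u)))
      (All.zip (∏oneMinusS-↭ n ks , ∏oneMinusS-below n ks))
  ∷ [])

SignCompatible : ℕ → ℚ × Word → Set
SignCompatible n e = ∀ u → length u ≡ n → Distinct u → sgn (compose u (proj₂ e)) ≡ proj₁ e Q.* sgn u

∏oneMinusS-signCompatible : ∀ n ks → All (λ k → suc (2 * k) < n) ks → All (SignCompatible n) (∏oneMinusS n ks)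
∏oneMinusS-signCompatible n [] _ =
  (λ u e d → Eq.trans (cong sgn (compose-identityʳ u n e)) (sym (QP.*-identityˡ (sgn u)))) ∷ []
∏oneMinusS-signCompatible n (k ∷ ks) (hk ∷ hks) = All-· {SignCompatible n} (oneMinusS n k) (∏oneMinusS n ks)
  ( All.map (λ {b} (h , h') u e d →
       Eq.trans (cong (λ z → sgn (compose u z)) (compose-identityˡ n (proj₂ b) h'))
         (Eq.trans (h u e d) (cong (Q._* sgn u) (sym (QP.*-identityˡ (proj₁ b))))))
       (All.zip (∏oneMinusS-signCompatible n ks hks , ∏oneMinusS-below n ks))
  ∷ All.map (λ {b} (h , h') u e d →
       Eq.trans (cong sgn (compose-s-assoc u n (2 * k) (proj₂ b) e h'))
        (Eq.trans (h (swapAt (2 * k) u) (Eq.trans (length-swapAt (2 * k) u) e)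
                     (Distinct-resp-↭ (↭-sym (swapAt-↭ (2 * k) u)) d))
        (Eq.trans (cong (proj₁ b Q.*_) (sgn-swapAt (2 * k) u (subst (suc (2 * k) <_) (sym e) hk) d))
          (neg-rearrange (proj₁ b) (sgn u)))))
       (All.zip (∏oneMinusS-signCompatible n ks hks , ∏oneMinusS-below n ks))
  ∷ [])
  where
  neg-rearrange : ∀ c x → c Q.* (Q.- x) ≡ (Q.- 1ℚ Q.* c) Q.* x
  neg-rearrange = +-*-Solver.solve 2 (λ c x → c :* (:- x) := (:- con 1ℚ :* c) :* x) refl
    where open +-*-Solver

flipSumAt : List ℕ → (Word → ℕ) → Word → ℕ
flipSumAt [] g u = g u
flipSumAt (k ∷ ks) g u = flipSumAt ks g u + flipSumAt ks g (swapAt (2 * k) u)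

∑∏oneMinusS-flipSumAt : ∀ n ks (g : Word → ℕ) u → length u ≡ n →
  ∑ (λ e → g (compose u (proj₂ e))) (∏oneMinusS n ks) ≡ flipSumAt ks g u
∑∏oneMinusS-flipSumAt n [] g u e = Eq.trans (NP.+-identityʳ _) (cong g (compose-identityʳ u n e))
∑∏oneMinusS-flipSumAt n (k ∷ ks) g u e =
  begin
    ∑ (λ e → g (compose u (proj₂ e))) (∏oneMinusS n (k ∷ ks))
  ≡⟨ ∑-· (λ e → g (compose u (proj₂ e))) (oneMinusS n k) (∏oneMinusS n ks) ⟩
    ∑ (λ b → g (compose u (compose (upTo n) (proj₂ b)))) (∏oneMinusS n ks)
      + (∑ (λ b → g (compose u (compose (s n (2 * k)) (proj₂ b)))) (∏oneMinusS n ks) + 0)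
  ≡⟨ cong₂ _+_ (∑-congᴬ (All.map (λ {b} h → cong (λ z → g (compose u z)) (compose-identityˡ n (proj₂ b) h))
                                 (∏oneMinusS-below n ks)))
               (Eq.trans (NP.+-identityʳ _)
                 (∑-congᴬ (All.map (λ {b} h → cong g (compose-s-assoc u n (2 * k) (proj₂ b) e h))
                                   (∏oneMinusS-below n ks)))) ⟩
    ∑ (λ b → g (compose u (proj₂ b))) (∏oneMinusS n ks)
      + ∑ (λ b → g (compose (swapAt (2 * k) u) (proj₂ b))) (∏oneMinusS n ks)
  ≡⟨ cong₂ _+_ (∑∏oneMinusS-flipSumAt n ks g u e)
               (∑∏oneMinusS-flipSumAt n ks g (swapAt (2 * k) u) (Eq.trans (length-swapAt (2 * k) u) e)) ⟩
    flipSumAt (k ∷ ks) g u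
  ∎
  where open ≡-Reasoning

-- flipSum m g u sums g over the 2^m words obtained from u by reversing any set of its m blocks.
flipSum : ℕ → (Word → ℕ) → Word → ℕ
flipSum zero g u = g u
flipSum (suc m) g (a ∷ b ∷ r) = flipSum m (λ r' → g (a ∷ b ∷ r')) r + flipSum m (λ r' → g (b ∷ a ∷ r')) r
flipSum (suc m) g _ = 0

flipSumAt-suc : ∀ ks (g : Word → ℕ) a b r →
  flipSumAt (map suc ks) g (a ∷ b ∷ r) ≡ flipSumAt ks (λ r' → g (a ∷ b ∷ r')) r
flipSumAt-suc [] g a b r = refl
flipSumAt-suc (k ∷ ks) g a b r =
  cong₂ _+_ (flipSumAt-suc ks g a b r)
    (Eq.trans (cong (λ z → flipSumAt (map suc ks) g (swapAt z (a ∷ b ∷ r))) (*-2-suc k))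
              (flipSumAt-suc ks g a b (swapAt (2 * k) r)))

flipSumAt-upTo : ∀ m g u → length u ≡ 2 * m → flipSumAt (upTo m) g u ≡ flipSum m g u
flipSumAt-upTo zero g u e = refl
flipSumAt-upTo (suc m) g [] e with () ← Eq.trans e (*-2-suc m)
flipSumAt-upTo (suc m) g (a ∷ []) e with () ← NP.suc-injective (Eq.trans e (*-2-suc m))
flipSumAt-upTo (suc m) g (a ∷ b ∷ r) e =
  Eq.trans (cong (λ z → flipSumAt z g (a ∷ b ∷ r) + flipSumAt z g (b ∷ a ∷ r)) (sym (LP.map-upTo suc m)))
  (cong₂ _+_ (Eq.trans (flipSumAt-suc (upTo m) g a b r) (flipSumAt-upTo m (λ r' → g (a ∷ b ∷ r')) r r-len))
             (Eq.trans (flipSumAt-suc (upTo m) g b a r) (flipSumAt-upTo m (λ r' → g (b ∷ a ∷ r')) r r-len)))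
  where r-len = length-dropPair {a} {b} {r} m e

∑Y-flipSum : ∀ m (g : Word → ℕ) u → length u ≡ 2 * m →
  ∑ (λ e → g (compose u (proj₂ e))) (Y m) ≡ flipSum m g u
∑Y-flipSum m g u e = Eq.trans (∑∏oneMinusS-flipSumAt (2 * m) (upTo m) g u e) (flipSumAt-upTo m g u e)

Y-signCompatible : ∀ m → All (SignCompatible (2 * m)) (Y m)
Y-signCompatible m = ∏oneMinusS-signCompatible (2 * m) (upTo m) (AllP.applyUpTo⁺₁ (λ x → x) m (odd< _ m))
  where
  odd< : ∀ i m → i < m → suc (2 * i) < 2 * m
  odd< zero (suc m) p = subst (1 <_) (sym (*-2-suc m)) (s≤s (s≤s z≤n))
  odd< (suc i) (suc m) (s≤s p) = subst₂ _<_ (cong suc (sym (*-2-suc i))) (sym (*-2-suc m)) (s≤s (s≤s (odd< i m p)))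

Y-↭ : ∀ m → All (λ e → ∀ u → length u ≡ 2 * m → compose u (proj₂ e) ↭ u) (Y m)
Y-↭ m = ∏oneMinusS-↭ (2 * m) (upTo m)

-- Sorting within blocks, and block flips

sortBlock : Block → Block
sortBlock (a , b) = if b <ᵇ a then (b , a) else (a , b)

sortBlocks : Word → Word
sortBlocks (a ∷ b ∷ r) = proj₁ (sortBlock (a , b)) ∷ proj₂ (sortBlock (a , b)) ∷ sortBlocks r
sortBlocks r = r

sortBlocks-flat : ∀ B → sortBlocks (flat B) ≡ flat (map sortBlock B)
sortBlocks-flat [] = refl
sortBlocks-flat ((a , b) ∷ B) = cong (λ z → _ ∷ _ ∷ z) (sortBlocks-flat B)

swapBlock : Block → Block
swapBlock (a , b) = (b , a)

sortBlock-cases : ∀ p → (sortBlock p ≡ p) ⊎ (sortBlock p ≡ swapBlock p)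
sortBlock-cases (a , b) with b <ᵇ a
... | true = inj₂ refl
... | false = inj₁ refl

sortBlock-swap : ∀ a b → a ≢ b → sortBlock (b , a) ≡ sortBlock (a , b)
sortBlock-swap a b ne with b <ᵇ a in e1 | a <ᵇ b in e2
... | true | true = ⊥-elim (NP.<-asym (<ᵇ-sound b a e1) (<ᵇ-sound a b e2))
... | false | false = ⊥-elim (ne (NP.≤-antisym (<ᵇ-false b a e1) (<ᵇ-false a b e2)))
... | true | false = refl
... | false | true = refl

sortBlock-inv : ∀ a b c d → sortBlock (a , b) ≡ sortBlock (c , d) → (a ≡ c × b ≡ d) ⊎ (b ≡ c × a ≡ d)
sortBlock-inv a b c d e with sortBlock-cases (a , b) | sortBlock-cases (c , d)
... | inj₁ p | inj₁ q = let z = Eq.trans (sym p) (Eq.trans e q) in inj₁ (cong proj₁ z , cong proj₂ z)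
... | inj₁ p | inj₂ q = let z = Eq.trans (sym p) (Eq.trans e q) in inj₂ (cong proj₂ z , cong proj₁ z)
... | inj₂ p | inj₁ q = let z = Eq.trans (sym p) (Eq.trans e q) in inj₂ (cong proj₁ z , cong proj₂ z)
... | inj₂ p | inj₂ q = let z = Eq.trans (sym p) (Eq.trans e q) in inj₁ (cong proj₂ z , cong proj₁ z)

blockEqᵇ : Block → Block → Bool
blockEqᵇ (a , b) (c , d) = (a ≡ᵇ c) ∧ (b ≡ᵇ d)

blockEqᵇ-sound : ∀ p q → blockEqᵇ p q ≡ true → p ≡ q
blockEqᵇ-sound (a , b) (c , d) e =
  cong₂ _,_ (≡ᵇ-sound a c (∧-trueˡ {a ≡ᵇ c} e)) (≡ᵇ-sound b d (∧-trueʳ {a ≡ᵇ c} e))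

blockEqᵇ-refl : ∀ p → blockEqᵇ p p ≡ true
blockEqᵇ-refl (a , b) rewrite ≡ᵇ-refl a | ≡ᵇ-refl b = refl

blockEqᵇ-≢ : ∀ p q → p ≢ q → blockEqᵇ p q ≡ false
blockEqᵇ-≢ p q ne with blockEqᵇ p q in e
... | true = ⊥-elim (ne (blockEqᵇ-sound p q e))
... | false = refl

𝟙-sortBlock-≡ : ∀ a b c d → a ≢ b →
  𝟙 ((a ≡ᵇ c) ∧ (b ≡ᵇ d)) + 𝟙 ((b ≡ᵇ c) ∧ (a ≡ᵇ d)) ≡ 𝟙 (blockEqᵇ (sortBlock (a , b)) (sortBlock (c , d)))
𝟙-sortBlock-≡ a b c d ne with (a ≡ᵇ c) ∧ (b ≡ᵇ d) in e1 | (b ≡ᵇ c) ∧ (a ≡ᵇ d) in e2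
... | true | true =
  ⊥-elim (ne (Eq.trans (≡ᵇ-sound a d (∧-trueʳ {b ≡ᵇ c} e2)) (sym (≡ᵇ-sound b d (∧-trueʳ {a ≡ᵇ c} e1)))))
... | true | false rewrite ≡ᵇ-sound a c (∧-trueˡ {a ≡ᵇ c} e1) | ≡ᵇ-sound b d (∧-trueʳ {a ≡ᵇ c} e1)
  = sym (cong 𝟙 (blockEqᵇ-refl (sortBlock (c , d))))
... | false | true rewrite sym (≡ᵇ-sound b c (∧-trueˡ {b ≡ᵇ c} e2)) | sym (≡ᵇ-sound a d (∧-trueʳ {b ≡ᵇ c} e2))
  = sym (cong 𝟙 (Eq.trans (cong (blockEqᵇ (sortBlock (a , b))) (sortBlock-swap a b ne))
                          (blockEqᵇ-refl (sortBlock (a , b)))))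
... | false | false with blockEqᵇ (sortBlock (a , b)) (sortBlock (c , d)) in e3
...   | false = refl
...   | true with sortBlock-inv a b c d (blockEqᵇ-sound _ _ e3)
...     | inj₁ (refl , refl) with () ← Eq.trans (sym e1) (cong₂ _∧_ (≡ᵇ-refl a) (≡ᵇ-refl b))
...     | inj₂ (refl , refl) with () ← Eq.trans (sym e2) (cong₂ _∧_ (≡ᵇ-refl b) (≡ᵇ-refl a))

IsFlip : ℕ → Word → Word → Set
IsFlip zero u x = x ≡ u
IsFlip (suc m) (a ∷ b ∷ r) x = Σ Word λ r' → IsFlip m r r' × ((x ≡ a ∷ b ∷ r') ⊎ (x ≡ b ∷ a ∷ r'))
IsFlip (suc m) _ x = ⊥

flipSum-congFlip : ∀ m {g h : Word → ℕ} u → (∀ x → IsFlip m u x → g x ≡ h x) →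
  flipSum m g u ≡ flipSum m h u
flipSum-congFlip zero u p = p u refl
flipSum-congFlip (suc m) (a ∷ b ∷ r) p =
  cong₂ _+_ (flipSum-congFlip m r (λ x fx → p _ (x , fx , inj₁ refl)))
            (flipSum-congFlip m r (λ x fx → p _ (x , fx , inj₂ refl)))
flipSum-congFlip (suc m) [] p = refl
flipSum-congFlip (suc m) (a ∷ []) p = refl

flipSum-cong : ∀ m {g h : Word → ℕ} u → (∀ x → g x ≡ h x) → flipSum m g u ≡ flipSum m h u
flipSum-cong m u p = flipSum-congFlip m u (λ x _ → p x)

flipSum-*ˡ : ∀ m c (g : Word → ℕ) u → flipSum m (λ x → c * g x) u ≡ c * flipSum m g u
flipSum-*ˡ zero c g u = refl
flipSum-*ˡ (suc m) c g (a ∷ b ∷ r)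
  rewrite flipSum-*ˡ m c (λ r' → g (a ∷ b ∷ r')) r | flipSum-*ˡ m c (λ r' → g (b ∷ a ∷ r')) r
  = sym (NP.*-distribˡ-+ c _ _)
flipSum-*ˡ (suc m) c g [] = sym (NP.*-zeroʳ c)
flipSum-*ˡ (suc m) c g (a ∷ []) = sym (NP.*-zeroʳ c)

flipSum-0 : ∀ m u → flipSum m (λ _ → 0) u ≡ 0
flipSum-0 zero u = refl
flipSum-0 (suc m) (a ∷ b ∷ r) rewrite flipSum-0 m r = refl
flipSum-0 (suc m) [] = refl
flipSum-0 (suc m) (a ∷ []) = refl

PairsDistinct : ℕ → Word → Set
PairsDistinct zero [] = ⊤
PairsDistinct zero (_ ∷ _) = ⊥
PairsDistinct (suc m) (a ∷ b ∷ r) = (a ≢ b) × PairsDistinct m r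
PairsDistinct (suc m) _ = ⊥

flipSum-wordEq : ∀ m u y → PairsDistinct m u →
  flipSum m (λ x → 𝟙 (wordEqᵇ x y)) u ≡ 𝟙 (wordEqᵇ (sortBlocks u) (sortBlocks y))
flipSum-wordEq zero [] [] pd = refl
flipSum-wordEq zero [] (x ∷ []) pd = refl
flipSum-wordEq zero [] (x ∷ z ∷ y) pd = refl
flipSum-wordEq (suc m) (a ∷ b ∷ r) [] pd rewrite flipSum-0 m r = refl
flipSum-wordEq (suc m) (a ∷ b ∷ r) (c ∷ []) pd
  rewrite flipSum-cong m {λ r' → 𝟙 ((a ≡ᵇ c) ∧ false)} {λ _ → 0} r (λ x → cong 𝟙 (BP.∧-zeroʳ (a ≡ᵇ c)))
        | flipSum-cong m {λ r' → 𝟙 ((b ≡ᵇ c) ∧ false)} {λ _ → 0} r (λ x → cong 𝟙 (BP.∧-zeroʳ (b ≡ᵇ c)))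
        | flipSum-0 m r = sym (cong 𝟙 (BP.∧-zeroʳ (proj₁ (sortBlock (a , b)) ≡ᵇ c)))
flipSum-wordEq (suc m) (a ∷ b ∷ r) (c ∷ d ∷ y) (a≢b , pd) =
  begin
    flipSum m (λ x → 𝟙 ((a ≡ᵇ c) ∧ ((b ≡ᵇ d) ∧ wordEqᵇ x y))) r
      + flipSum m (λ x → 𝟙 ((b ≡ᵇ c) ∧ ((a ≡ᵇ d) ∧ wordEqᵇ x y))) r
  ≡⟨ cong₂ _+_ (pull (a ≡ᵇ c) (b ≡ᵇ d)) (pull (b ≡ᵇ c) (a ≡ᵇ d)) ⟩
    𝟙 ((a ≡ᵇ c) ∧ (b ≡ᵇ d)) * rest + 𝟙 ((b ≡ᵇ c) ∧ (a ≡ᵇ d)) * rest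
  ≡⟨ sym (NP.*-distribʳ-+ rest (𝟙 ((a ≡ᵇ c) ∧ (b ≡ᵇ d))) _) ⟩
    (𝟙 ((a ≡ᵇ c) ∧ (b ≡ᵇ d)) + 𝟙 ((b ≡ᵇ c) ∧ (a ≡ᵇ d))) * rest
  ≡⟨ cong₂ _*_ (𝟙-sortBlock-≡ a b c d a≢b) (flipSum-wordEq m r y pd) ⟩
    𝟙 (blockEqᵇ (sortBlock (a , b)) (sortBlock (c , d))) * 𝟙 (wordEqᵇ (sortBlocks r) (sortBlocks y))
  ≡⟨ sym (𝟙-∧∧ (proj₁ (sortBlock (a , b)) ≡ᵇ proj₁ (sortBlock (c , d)))
               (proj₂ (sortBlock (a , b)) ≡ᵇ proj₂ (sortBlock (c , d))) (wordEqᵇ (sortBlocks r) (sortBlocks y))) ⟩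
    𝟙 (wordEqᵇ (sortBlocks (a ∷ b ∷ r)) (sortBlocks (c ∷ d ∷ y)))
  ∎
  where
  open ≡-Reasoning
  rest = flipSum m (λ x → 𝟙 (wordEqᵇ x y)) r
  𝟙-∧∧ : ∀ p q w → 𝟙 (p ∧ (q ∧ w)) ≡ 𝟙 (p ∧ q) * 𝟙 w
  𝟙-∧∧ p q w = Eq.trans (cong 𝟙 (sym (BP.∧-assoc p q w))) (𝟙-∧ (p ∧ q) w)
  pull : ∀ p q → flipSum m (λ x → 𝟙 (p ∧ (q ∧ wordEqᵇ x y))) r ≡ 𝟙 (p ∧ q) * rest
  pull p q = Eq.trans (flipSum-cong m r (λ x → 𝟙-∧∧ p q (wordEqᵇ x y))) (flipSum-*ˡ m (𝟙 (p ∧ q)) _ r)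

IsFlip-sortBlocks : ∀ m u x → PairsDistinct m u → IsFlip m u x → sortBlocks x ≡ sortBlocks u
IsFlip-sortBlocks zero u x pd refl = refl
IsFlip-sortBlocks (suc m) (a ∷ b ∷ r) x (ne , pd) (r' , f , inj₁ refl) =
  cong (λ z → _ ∷ _ ∷ z) (IsFlip-sortBlocks m r r' pd f)
IsFlip-sortBlocks (suc m) (a ∷ b ∷ r) x (ne , pd) (r' , f , inj₂ refl) =
  cong₂ (λ p z → proj₁ p ∷ proj₂ p ∷ z) (sortBlock-swap a b ne) (IsFlip-sortBlocks m r r' pd f)

IsFlip-↭ : ∀ m u x → IsFlip m u x → x ↭ u
IsFlip-↭ zero u x refl = refl
IsFlip-↭ (suc m) (a ∷ b ∷ r) x (r' , f , inj₁ refl) = prep a (prep b (IsFlip-↭ m r r' f))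
IsFlip-↭ (suc m) (a ∷ b ∷ r) x (r' , f , inj₂ refl) = swap b a (IsFlip-↭ m r r' f)

flipSum-pointMass : ∀ m (g : Word → ℕ) u x0 c → PairsDistinct m u →
  (∀ x → IsFlip m u x → g x ≡ 𝟙 (wordEqᵇ x x0) * c) →
  flipSum m g u ≡ 𝟙 (wordEqᵇ (sortBlocks u) (sortBlocks x0)) * c
flipSum-pointMass m g u x0 c pd h =
  Eq.trans (flipSum-congFlip m u h)
   (Eq.trans (flipSum-cong m u (λ x → NP.*-comm (𝟙 (wordEqᵇ x x0)) c))
    (Eq.trans (flipSum-*ˡ m c (λ x → 𝟙 (wordEqᵇ x x0)) u)
     (Eq.trans (cong (c *_) (flipSum-wordEq m u x0 pd)) (NP.*-comm c _))))


elemBlockᵇ : Block → List Block → Bool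
elemBlockᵇ b [] = false
elemBlockᵇ b (c ∷ C) = blockEqᵇ c b ∨ elemBlockᵇ b C

elemBlockᵇ-sound : ∀ b C → elemBlockᵇ b C ≡ true → b ∈ C
elemBlockᵇ-sound b (c ∷ C) e with blockEqᵇ c b in e1
... | true = here (sym (blockEqᵇ-sound c b e1))
... | false = there (elemBlockᵇ-sound b C e)

elemBlockᵇ-complete : ∀ b C → b ∈ C → elemBlockᵇ b C ≡ true
elemBlockᵇ-complete b (c ∷ C) (here refl) rewrite blockEqᵇ-refl b = refl
elemBlockᵇ-complete b (c ∷ C) (there m) rewrite elemBlockᵇ-complete b C m = BP.∨-zeroʳ (blockEqᵇ c b)

orientAs : List Block → Block → Block
orientAs C b = if elemBlockᵇ b C then b else swapBlock b

orientAs-∈ : ∀ C b → b ∈ C → orientAs C b ≡ b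
orientAs-∈ C b m rewrite elemBlockᵇ-complete b C m = refl

orientAs-∉ : ∀ C b → b ∉ C → orientAs C b ≡ swapBlock b
orientAs-∉ C b nm with elemBlockᵇ b C in e
... | true = ⊥-elim (nm (elemBlockᵇ-sound b C e))
... | false = refl

orientAs-cases : ∀ C b → (orientAs C b ≡ b) ⊎ (orientAs C b ≡ swapBlock b)
orientAs-cases C b with elemBlockᵇ b C
... | true = inj₁ refl
... | false = inj₂ refl

sortBlock-id : ∀ a b → a < b → sortBlock (a , b) ≡ (a , b)
sortBlock-id a b ab with b <ᵇ a in e
... | true = ⊥-elim (NP.<-asym ab (<ᵇ-sound b a e))
... | false = refl

sortBlock-orientAs : ∀ C a b → a < b → sortBlock (orientAs C (a , b)) ≡ (a , b)
sortBlock-orientAs C a b ab with orientAs-cases C (a , b)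
... | inj₁ e rewrite e = sortBlock-id a b ab
... | inj₂ e rewrite e = Eq.trans (sortBlock-swap a b (λ q → NP.<-irrefl q ab)) (sortBlock-id a b ab)

orientAs-sortBlock : ∀ C c → Distinct (flat C) → c ∈ C → proj₁ c ≢ proj₂ c → orientAs C (sortBlock c) ≡ c
orientAs-sortBlock C (a , b) d m ne with sortBlock-cases (a , b)
... | inj₁ e rewrite e = orientAs-∈ C (a , b) m
... | inj₂ e rewrite e = orientAs-∉ C (b , a) (λ m' → ne (Distinct-noTwins C a b d m m'))

IsFlip-orientAs : ∀ C B → IsFlip (length B) (flat B) (flat (map (orientAs C) B))
IsFlip-orientAs C [] = refl
IsFlip-orientAs C ((a , b) ∷ B) with orientAs-cases C (a , b)
... | inj₁ e = _ , IsFlip-orientAs C B , inj₁ (cong (λ p → proj₁ p ∷ proj₂ p ∷ flat (map (orientAs C) B)) e)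
... | inj₂ e = _ , IsFlip-orientAs C B , inj₂ (cong (λ p → proj₁ p ∷ proj₂ p ∷ flat (map (orientAs C) B)) e)

IsFlip-∈⇒orientAs : ∀ C B x → Distinct (flat C) → All (λ z → proj₁ z ≢ proj₂ z) B →
  IsFlip (length B) (flat B) x → All (_∈ C) (blocks x) → x ≡ flat (map (orientAs C) B)
IsFlip-∈⇒orientAs C [] x d _ refl _ = refl
IsFlip-∈⇒orientAs C ((a , b) ∷ B) x d (ne ∷ nes) (r , f , inj₁ refl) (m ∷ ms) =
  cong₂ (λ p z → proj₁ p ∷ proj₂ p ∷ z) (sym (orientAs-∈ C (a , b) m)) (IsFlip-∈⇒orientAs C B r d nes f ms)
IsFlip-∈⇒orientAs C ((a , b) ∷ B) x d (ne ∷ nes) (r , f , inj₂ refl) (m ∷ ms) =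
  cong₂ (λ p z → proj₁ p ∷ proj₂ p ∷ z) (sym (orientAs-∉ C (a , b) (λ m' → ne (Distinct-noTwins C a b d m' m))))
        (IsFlip-∈⇒orientAs C B r d nes f ms)

IsFlip-length : ∀ m u x → IsFlip m u x → length x ≡ length u
IsFlip-length m u x f = PermP.↭-length (IsFlip-↭ m u x f)

PairsDistinct-flat : ∀ B → All (λ z → proj₁ z ≢ proj₂ z) B → PairsDistinct (length B) (flat B)
PairsDistinct-flat [] _ = tt
PairsDistinct-flat ((a , b) ∷ B) (ne ∷ nes) = ne , PairsDistinct-flat B nes

map-sortBlock-id : ∀ B → All (λ z → proj₁ z < proj₂ z) B → map sortBlock B ≡ B
map-sortBlock-id [] _ = refl
map-sortBlock-id ((a , b) ∷ B) (p ∷ ps) = cong₂ _∷_ (sortBlock-id a b p) (map-sortBlock-id B ps)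

<⇒≢ᴬ : ∀ {B : List Block} → All (λ z → proj₁ z < proj₂ z) B → All (λ z → proj₁ z ≢ proj₂ z) B
<⇒≢ᴬ = All.map (λ p e → NP.<-irrefl e p)


sortBlock-< : ∀ a b → a ≢ b → proj₁ (sortBlock (a , b)) < proj₂ (sortBlock (a , b))
sortBlock-< a b ne with b <ᵇ a in e
... | true = <ᵇ-sound b a e
... | false = NP.≤∧≢⇒< (<ᵇ-false b a e) ne

sortBlocks-↭ : ∀ x → sortBlocks x ↭ x
sortBlocks-↭ [] = refl
sortBlocks-↭ (a ∷ []) = refl
sortBlocks-↭ (a ∷ b ∷ r) with b <ᵇ a
... | true = swap b a (sortBlocks-↭ r)
... | false = prep a (prep b (sortBlocks-↭ r))

-- Block shuffles: the words x β_π

indexOf : List Block → Block → ℕ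
indexOf [] _ = 0
indexOf (c ∷ B) x = if blockEqᵇ c x then 0 else suc (indexOf B x)

blockAt-indexOf : ∀ {x} B → x ∈ B → blockAt B (indexOf B x) ≡ x
blockAt-indexOf {x} (c ∷ B) m with blockEqᵇ c x in e
... | true = blockEqᵇ-sound c x e
blockAt-indexOf {x} (c ∷ B) (here refl) | false with () ← Eq.trans (sym e) (blockEqᵇ-refl c)
blockAt-indexOf {x} (c ∷ B) (there m) | false = blockAt-indexOf B m

indexOf-lt : ∀ {x} B → x ∈ B → indexOf B x < length B
indexOf-lt {x} (c ∷ B) m with blockEqᵇ c x in e
... | true = s≤s z≤n
indexOf-lt {x} (c ∷ B) (here refl) | false with () ← Eq.trans (sym e) (blockEqᵇ-refl c)
indexOf-lt {x} (c ∷ B) (there m) | false = s≤s (indexOf-lt B m)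

blockAt-∈ : ∀ B i → i < length B → blockAt B i ∈ B
blockAt-∈ (c ∷ B) zero _ = here refl
blockAt-∈ (c ∷ B) (suc i) (s≤s p) = there (blockAt-∈ B i p)

indexOf-blockAt : ∀ B i → Distinct B → i < length B → indexOf B (blockAt B i) ≡ i
indexOf-blockAt (c ∷ B) zero d _ rewrite blockEqᵇ-refl c = refl
indexOf-blockAt (c ∷ B) (suc i) (nc ∷ d) (s≤s p)
  rewrite blockEqᵇ-≢ c (blockAt B i) (λ e → nc (subst (_∈ B) (sym e) (blockAt-∈ B i p)))
  = cong suc (indexOf-blockAt B i d p)

map-blockAt-upTo : ∀ B → map (blockAt B) (upTo (length B)) ≡ B
map-blockAt-upTo [] = refl
map-blockAt-upTo (c ∷ B) = cong (c ∷_) (Eq.trans (LP.map-applyUpTo suc (blockAt (c ∷ B)) (length B))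
                                     (Eq.trans (sym (LP.map-upTo (blockAt B) (length B))) (map-blockAt-upTo B)))

map-blockAt-↭ : ∀ B π → IsPerm (length B) π → map (blockAt B) π ↭ B
map-blockAt-↭ B π vπ =
  subst (map (blockAt B) π ↭_) (map-blockAt-upTo B) (PermP.map⁺ (blockAt B) (IsPerm⇒↭upTo (length B) π vπ))

-- The only candidate for π with x β_π = y: the positions of the blocks of y among those of x.
blockIndices : Word → Word → Word
blockIndices x y = map (indexOf (blocks x)) (blocks y)

isShuffleᵇ : ℕ → Word → Word → Bool
isShuffleᵇ m x y = isPermᵇ m (blockIndices x y) ∧ wordEqᵇ (compose x (β (blockIndices x y))) y

compose-β : ∀ m x π → length x ≡ 2 * m → compose x (β π) ≡ flat (map (blockAt (blocks x)) π)
compose-β m x π e = Eq.trans (cong (λ z → compose z (β π)) (sym (flat-blocks m x e))) (compose-flat-β (blocks x) π)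

shuffle-injective : ∀ m x π y → IsPerm m π → length x ≡ 2 * m → Distinct x →
  compose x (β π) ≡ y → π ≡ blockIndices x y
shuffle-injective m x π y (mkIsPerm _ below _) lx dx refl = sym (begin
    map (indexOf (blocks x)) (blocks (compose x (β π)))
  ≡⟨ cong (λ z → map (indexOf (blocks x)) (blocks z)) (compose-β m x π lx) ⟩
    map (indexOf (blocks x)) (blocks (flat (map (blockAt (blocks x)) π)))
  ≡⟨ cong (map (indexOf (blocks x))) (blocks-flat _) ⟩
    map (indexOf (blocks x)) (map (blockAt (blocks x)) π)
  ≡⟨ sym (LP.map-∘ π) ⟩
    map (λ i → indexOf (blocks x) (blockAt (blocks x) i)) π
  ≡⟨ LP.map-cong-local (All.map (λ {i} p → indexOf-blockAt (blocks x) i dB (subst (i <_) (sym (length-blocks m x lx)) p)) below) ⟩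
    map (λ i → i) π
  ≡⟨ LP.map-id π ⟩
    π
  ∎)
  where
  open ≡-Reasoning
  dB : Distinct (blocks x)
  dB = Distinct-blocks (blocks x) (subst Distinct (sym (flat-blocks m x lx)) dx)

∑Θ-shuffle : ∀ m x y → length x ≡ 2 * m → Distinct x →
  ∑ (λ π → 𝟙 (wordEqᵇ (compose x (β π)) y)) (perms m) ≡ 𝟙 (isShuffleᵇ m x y)
∑Θ-shuffle m x y e d =
  Eq.trans (∑-pointMass (blockIndices x y) _ (perms m) (All.tabulate only-candidate))
   (Eq.trans (cong (_* _) (count-perms m (blockIndices x y))) (sym (𝟙-∧ (isPermᵇ m (blockIndices x y)) _)))
  where
  only-candidate : ∀ {π} → π ∈ perms m → 𝟙 (wordEqᵇ (compose x (β π)) y)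
    ≡ 𝟙 (wordEqᵇ π (blockIndices x y)) * 𝟙 (wordEqᵇ (compose x (β (blockIndices x y))) y)
  only-candidate {π} mem = 𝟙-unique (λ π → wordEqᵇ (compose x (β π)) y) π (blockIndices x y)
    (λ hit → shuffle-injective m x π y (∈perms⇒IsPerm mem) e d (wordEqᵇ-sound _ y hit))

isShuffleᵇ-sound : ∀ m x y → isShuffleᵇ m x y ≡ true → length x ≡ 2 * m →
  blocks y ↭ blocks x × flat (blocks y) ≡ y
isShuffleᵇ-sound m x y D e = p1 , p2
  where
  vπ = isPermᵇ-sound m (blockIndices x y) (∧-trueˡ {isPermᵇ m (blockIndices x y)} D)
  ey : compose x (β (blockIndices x y)) ≡ y
  ey = wordEqᵇ-sound _ _ (∧-trueʳ {isPermᵇ m (blockIndices x y)} D)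
  ey' : y ≡ flat (map (blockAt (blocks x)) (blockIndices x y))
  ey' = Eq.trans (sym ey) (compose-β m x (blockIndices x y) e)
  p1 : blocks y ↭ blocks x
  p1 = subst (λ z → blocks z ↭ blocks x) (sym ey')
         (subst (_↭ blocks x) (sym (blocks-flat _))
           (map-blockAt-↭ (blocks x) (blockIndices x y) (subst (λ k → IsPerm k _) (sym (length-blocks m x e)) vπ)))
  p2 : flat (blocks y) ≡ y
  p2 = Eq.trans (cong (λ z → flat (blocks z)) ey') (Eq.trans (cong flat (blocks-flat _)) (sym ey'))

isShuffleᵇ-complete : ∀ m x y → blocks y ↭ blocks x → flat (blocks y) ≡ y → length x ≡ 2 * m → Distinct x →
  isShuffleᵇ m x y ≡ true
isShuffleᵇ-complete m x y p fy lx dx =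
  Eq.trans (cong₂ _∧_ (isPermᵇ-complete perm-π) (cong (λ z → wordEqᵇ z y) ey)) (wordEqᵇ-refl y)
  where
  Bx = blocks x
  By = blocks y
  dB : Distinct Bx
  dB = Distinct-blocks Bx (subst Distinct (sym (flat-blocks m x lx)) dx)
  mem : ∀ {c} → c ∈ By → c ∈ Bx
  mem c = PermP.∈-resp-↭ p c
  indexOf-injective : ∀ {a b} → a ∈ By → b ∈ By → indexOf Bx a ≡ indexOf Bx b → a ≡ b
  indexOf-injective a b eq =
    Eq.trans (sym (blockAt-indexOf Bx (mem a))) (Eq.trans (cong (blockAt Bx) eq) (blockAt-indexOf Bx (mem b)))
  perm-π : IsPerm m (blockIndices x y)
  perm-π = mkIsPerm (Eq.trans (LP.length-map _ By) (Eq.trans (PermP.↭-length p) (length-blocks m x lx)))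
    (AllP.map⁺ (All.tabulate (λ c → subst (indexOf Bx _ <_) (length-blocks m x lx) (indexOf-lt Bx (mem c)))))
    (Distinct-map-injective (indexOf Bx) indexOf-injective (Distinct-resp-↭ (↭-sym p) dB))
  ey : compose x (β (blockIndices x y)) ≡ y
  ey = begin
      compose x (β (blockIndices x y))
    ≡⟨ compose-β m x (blockIndices x y) lx ⟩
      flat (map (blockAt Bx) (map (indexOf Bx) By))
    ≡⟨ cong flat (sym (LP.map-∘ By)) ⟩
      flat (map (λ c → blockAt Bx (indexOf Bx c)) By)
    ≡⟨ cong flat (Eq.trans (LP.map-cong-local (All.tabulate (λ c → blockAt-indexOf Bx (mem c)))) (LP.map-id By)) ⟩
      flat By
    ≡⟨ fy ⟩
      y
    ∎
    where open ≡-Reasoning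

compose-β-↭ : ∀ m x π → length x ≡ 2 * m → IsPerm m π → compose x (β π) ↭ x
compose-β-↭ m x π lx vπ =
  subst₂ _↭_ (sym (compose-β m x π lx)) (flat-blocks m x lx)
         (flat-↭ (map-blockAt-↭ (blocks x) π (subst (λ k → IsPerm k π) (sym (length-blocks m x lx)) vπ)))

sgn-compose-β : ∀ m x π → length x ≡ 2 * m → Distinct x → IsPerm m π → sgn (compose x (β π)) ≡ sgn x
sgn-compose-β m x π lx dx vπ =
  begin
    sgn (compose x (β π))
  ≡⟨ cong sgn (compose-β m x π lx) ⟩
    sgn (flat (map (blockAt (blocks x)) π))
  ≡⟨ sym (sgn-flat-↭ (↭-sym shuffled) (subst Distinct (sym fx) dx)) ⟩
    sgn (flat (blocks x))
  ≡⟨ cong sgn fx ⟩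
    sgn x
  ∎
  where
  open ≡-Reasoning
  fx = flat-blocks m x lx
  shuffled = map-blockAt-↭ (blocks x) π (subst (λ k → IsPerm k π) (sym (length-blocks m x lx)) vπ)
-- Pfaffian words

insertByMax : Block → List Block → List Block
insertByMax x [] = x ∷ []
insertByMax x (y ∷ ys) = if proj₂ x <ᵇ proj₂ y then x ∷ y ∷ ys else y ∷ insertByMax x ys

sortByMax : List Block → List Block
sortByMax [] = []
sortByMax (x ∷ xs) = insertByMax x (sortByMax xs)

insertByMax-↭ : ∀ x ys → insertByMax x ys ↭ x ∷ ys
insertByMax-↭ x [] = refl
insertByMax-↭ x (y ∷ ys) with proj₂ x <ᵇ proj₂ y
... | true = refl
... | false = trans (prep y (insertByMax-↭ x ys)) (swap y x refl)

sortByMax-↭ : ∀ xs → sortByMax xs ↭ xs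
sortByMax-↭ [] = refl
sortByMax-↭ (x ∷ xs) = trans (insertByMax-↭ x (sortByMax xs)) (prep x (sortByMax-↭ xs))

-- The block form of pfGo: i < j in every block, and maxima j increasing and ≥ b.
PfBlocks : ℕ → List Block → Set
PfBlocks b [] = ⊤
PfBlocks b ((i , j) ∷ B) = i < j × b ≤ j × PfBlocks (suc j) B

PfBlocks⇒sorted : ∀ b B → PfBlocks b B → All (λ z → proj₁ z < proj₂ z) B
PfBlocks⇒sorted b [] _ = []
PfBlocks⇒sorted b ((i , j) ∷ B) (ij , _ , pb) = ij ∷ PfBlocks⇒sorted (suc j) B pb

PfBlocks-max-≥ : ∀ c C z → PfBlocks c C → z ∈ C → c ≤ proj₂ z
PfBlocks-max-≥ c ((i , j) ∷ C) z (_ , cj , _) (here refl) = cj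
PfBlocks-max-≥ c ((i , j) ∷ C) z (_ , cj , pc) (there m) =
  NP.≤-trans cj (NP.<⇒≤ (PfBlocks-max-≥ (suc j) C z pc m))

PfBlocks-↭-unique : ∀ b c B C → PfBlocks b B → PfBlocks c C → B ↭ C → B ≡ C
PfBlocks-↭-unique b c [] C pb pc p = sym (PermP.↭-empty-inv (↭-sym p))
PfBlocks-↭-unique b c (x ∷ B) [] pb pc p with () ← PermP.↭-empty-inv p
PfBlocks-↭-unique b c ((i , j) ∷ B) ((k , l) ∷ C) (_ , _ , pb) (_ , _ , pc) p
  with PermP.∈-resp-↭ p (here refl) | PermP.∈-resp-↭ (↭-sym p) (here refl)
... | here refl | _ = cong ((i , j) ∷_) (PfBlocks-↭-unique (suc j) (suc j) B C pb pc (PermP.drop-∷ p))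
... | there m₁ | here refl = cong ((i , j) ∷_) (PfBlocks-↭-unique (suc j) (suc j) B C pb pc (PermP.drop-∷ p))
... | there m₁ | there m₂ =
  ⊥-elim (NP.<-asym (PfBlocks-max-≥ (suc l) C (i , j) pc m₁) (PfBlocks-max-≥ (suc j) B (k , l) pb m₂))

insertByMax-PfBlocks : ∀ b i j ys → PfBlocks b ys → i < j → b ≤ j → All (λ z → proj₂ z ≢ j) ys →
  PfBlocks b (insertByMax (i , j) ys)
insertByMax-PfBlocks b i j [] pb ij bj _ = ij , bj , tt
insertByMax-PfBlocks b i j ((k , l) ∷ ys) (kl , bl , pb) ij bj (ne ∷ nes) with j <ᵇ l in e
... | true = ij , bj , kl , <ᵇ-sound j l e , pb
... | false = kl , bl , insertByMax-PfBlocks (suc l) i j ys pb ij (NP.≤∧≢⇒< (<ᵇ-false j l e) ne) nes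

sortByMax-PfBlocks : ∀ B → All (λ z → proj₁ z < proj₂ z) B → Distinct (flat B) → PfBlocks 0 (sortByMax B)
sortByMax-PfBlocks [] _ _ = tt
sortByMax-PfBlocks ((i , j) ∷ B) (ij ∷ as) (_ ∷ (nj ∷ d)) =
  insertByMax-PfBlocks 0 i j (sortByMax B) (sortByMax-PfBlocks B as d) ij z≤n
    (All.tabulate (λ {z} m e → nj (subst (_∈ flat B) e (∈-flat₂ {proj₁ z} B (PermP.∈-resp-↭ (sortByMax-↭ B) m)))))

PfBlocks⇒pfGo : ∀ b B → PfBlocks b B → pfGo b (flat B) ≡ true
PfBlocks⇒pfGo b [] _ = refl
PfBlocks⇒pfGo b ((i , j) ∷ B) (ij , bj , pb)
  rewrite <ᵇ-complete i j ij | ≤ᵇ-complete b j bj = PfBlocks⇒pfGo (suc j) B pb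

pfGo⇒PfBlocks : ∀ b w → pfGo b w ≡ true → flat (blocks w) ≡ w × PfBlocks b (blocks w)
pfGo⇒PfBlocks b [] _ = refl , tt
pfGo⇒PfBlocks b (x ∷ []) ()
pfGo⇒PfBlocks b (i ∷ j ∷ r) e with pfGo⇒PfBlocks (suc j) r (∧-trueʳ {b ≤ᵇ j} (∧-trueʳ {i <ᵇ j} e))
... | fr , pr = cong (λ z → i ∷ j ∷ z) fr , <ᵇ-sound i j (∧-trueˡ {i <ᵇ j} e) ,
                ≤ᵇ-sound b j (∧-trueˡ {b ≤ᵇ j} (∧-trueʳ {i <ᵇ j} e)) , pr

pfWords : ℕ → List Word
pfWords n = filterᵇ pfCond (perms n)

count-pfWords : ∀ n w → count w (pfWords n) ≡ 𝟙 (pfCond w) * 𝟙 (isPermᵇ n w)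
count-pfWords n w = Eq.trans (count-filter pfCond w (perms n)) (cong (𝟙 (pfCond w) *_) (count-perms n w))

∈pfWords : ∀ {n w} → w ∈ pfWords n → pfCond w ≡ true × isPermᵇ n w ≡ true
∈pfWords {n} {w} m with pfCond w | isPermᵇ n w | subst (1 ≤_) (count-pfWords n w) (∈⇒count-pos m)
... | true | true | _ = refl , refl

pfWordOf : Word → Word
pfWordOf v = flat (sortByMax (blocks v))

pfWordOf-unique : ∀ m v {w} → w ∈ pfWords (2 * m) → isShuffleᵇ m w v ≡ true → w ≡ pfWordOf v
pfWordOf-unique m v {w} mem shuffle = Eq.trans (sym flat-w) (cong flat (sym same-blocks))
  where
  pfc = proj₁ (∈pfWords {2 * m} mem)
  vw = isPermᵇ-sound (2 * m) w (proj₂ (∈pfWords {2 * m} mem))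
  flat-w = proj₁ (pfGo⇒PfBlocks 0 w pfc)
  pf-w = proj₂ (pfGo⇒PfBlocks 0 w pfc)
  p : blocks v ↭ blocks w
  p = proj₁ (isShuffleᵇ-sound m w v shuffle (IsPerm.length≡ vw))
  sorted-v : All (λ z → proj₁ z < proj₂ z) (blocks v)
  sorted-v = PermP.All-resp-↭ (↭-sym p) (PfBlocks⇒sorted 0 (blocks w) pf-w)
  distinct-v : Distinct (flat (blocks v))
  distinct-v = Distinct-resp-↭ (flat-↭ (↭-sym p)) (subst Distinct (sym flat-w) (IsPerm.distinct vw))
  same-blocks : sortByMax (blocks v) ≡ blocks w
  same-blocks = PfBlocks-↭-unique 0 0 (sortByMax (blocks v)) (blocks w)
                  (sortByMax-PfBlocks (blocks v) sorted-v distinct-v) pf-w (trans (sortByMax-↭ (blocks v)) p)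

module _ (m : ℕ) (σ : Word) where
  private
    v = sortBlocks σ
    w₀ = pfWordOf v
    IsPfShuffle = (pfCond w₀ ∧ isPermᵇ (2 * m) w₀) ∧ isShuffleᵇ m w₀ v

    pfShuffle⇒isPerm : IsPfShuffle ≡ true → isPermᵇ (2 * m) σ ≡ true
    pfShuffle⇒isPerm e = isPermᵇ-complete (IsPerm-resp-↭ (sortBlocks-↭ σ) perm-v)
      where
      perm-w₀ = isPermᵇ-sound (2 * m) w₀ (∧-trueʳ {pfCond w₀} (∧-trueˡ {pfCond w₀ ∧ isPermᵇ (2 * m) w₀} e))
      shuffle = isShuffleᵇ-sound m w₀ v (∧-trueʳ {pfCond w₀ ∧ isPermᵇ (2 * m) w₀} e) (IsPerm.length≡ perm-w₀)
      perm-v : IsPerm (2 * m) v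
      perm-v = IsPerm-resp-↭ (subst₂ _↭_ (flat-blocks m w₀ (IsPerm.length≡ perm-w₀)) (proj₂ shuffle)
                                       (flat-↭ (↭-sym (proj₁ shuffle)))) perm-w₀

    isPerm⇒pfShuffle : isPermᵇ (2 * m) σ ≡ true → IsPfShuffle ≡ true
    isPerm⇒pfShuffle e = Eq.trans (cong₂ (λ a b → (a ∧ b) ∧ isShuffleᵇ m w₀ v) pf (isPermᵇ-complete perm-w₀)) shuffle
      where
      perm-σ = isPermᵇ-sound (2 * m) σ e
      perm-v : IsPerm (2 * m) v
      perm-v = IsPerm-resp-↭ (↭-sym (sortBlocks-↭ σ)) perm-σ
      flat-σ : flat (blocks σ) ≡ σ
      flat-σ = flat-blocks m σ (IsPerm.length≡ perm-σ)
      blocks-v : blocks v ≡ map sortBlock (blocks σ)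
      blocks-v = Eq.trans (cong (λ z → blocks (sortBlocks z)) (sym flat-σ))
                          (Eq.trans (cong blocks (sortBlocks-flat (blocks σ))) (blocks-flat _))
      flat-v : flat (blocks v) ≡ v
      flat-v = flat-blocks m v (IsPerm.length≡ perm-v)
      sorted-v : All (λ z → proj₁ z < proj₂ z) (blocks v)
      sorted-v = subst (All (λ z → proj₁ z < proj₂ z)) (sym blocks-v)
        (AllP.map⁺ (All.map (λ {z} ne → sortBlock-< (proj₁ z) (proj₂ z) ne)
                            (Distinct-blocks-≢ (blocks σ) (subst Distinct (sym flat-σ) (IsPerm.distinct perm-σ)))))
      pf : pfCond w₀ ≡ true
      pf = PfBlocks⇒pfGo 0 (sortByMax (blocks v))
             (sortByMax-PfBlocks (blocks v) sorted-v (subst Distinct (sym flat-v) (IsPerm.distinct perm-v)))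
      perm-w₀ : IsPerm (2 * m) w₀
      perm-w₀ = IsPerm-resp-↭ (↭-sym (subst (w₀ ↭_) flat-v (flat-↭ (sortByMax-↭ (blocks v))))) perm-v
      shuffle : (true ∧ true) ∧ isShuffleᵇ m w₀ v ≡ true
      shuffle = isShuffleᵇ-complete m w₀ v
                  (subst (blocks v ↭_) (sym (blocks-flat (sortByMax (blocks v)))) (↭-sym (sortByMax-↭ (blocks v))))
                  flat-v (IsPerm.length≡ perm-w₀) (IsPerm.distinct perm-w₀)

  ∑pfWords-isShuffle : ∑ (λ w → 𝟙 (isShuffleᵇ m w (sortBlocks σ))) (pfWords (2 * m)) ≡ 𝟙 (isPermᵇ (2 * m) σ)
  ∑pfWords-isShuffle =
    begin
      ∑ (λ w → 𝟙 (isShuffleᵇ m w v)) (pfWords (2 * m))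
    ≡⟨ ∑-pointMass w₀ _ (pfWords (2 * m))
         (All.tabulate λ {w} mem → 𝟙-unique (λ w → isShuffleᵇ m w v) w w₀ (pfWordOf-unique m v mem)) ⟩
      count w₀ (pfWords (2 * m)) * 𝟙 (isShuffleᵇ m w₀ v)
    ≡⟨ cong (_* 𝟙 (isShuffleᵇ m w₀ v)) (Eq.trans (count-pfWords (2 * m) w₀) (sym (𝟙-∧ (pfCond w₀) _))) ⟩
      𝟙 (pfCond w₀ ∧ isPermᵇ (2 * m) w₀) * 𝟙 (isShuffleᵇ m w₀ v)
    ≡⟨ sym (𝟙-∧ (pfCond w₀ ∧ isPermᵇ (2 * m) w₀) (isShuffleᵇ m w₀ v)) ⟩
      𝟙 IsPfShuffle
    ≡⟨ cong 𝟙 (Bool-ext pfShuffle⇒isPerm isPerm⇒pfShuffle) ⟩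
      𝟙 (isPermᵇ (2 * m) σ)
    ∎
    where open ≡-Reasoning

SortedBlocks : Word → Set
SortedBlocks w = All (λ z → proj₁ z < proj₂ z) (blocks w)

∈pfWords⇒IsPerm : ∀ {n w} → w ∈ pfWords n → IsPerm n w
∈pfWords⇒IsPerm {n} {w} mem = isPermᵇ-sound n w (proj₂ (∈pfWords {n} mem))

∈pfWords⇒SortedBlocks : ∀ {n w} → w ∈ pfWords n → SortedBlocks w
∈pfWords⇒SortedBlocks {n} {w} mem =
  PfBlocks⇒sorted 0 (blocks w) (proj₂ (pfGo⇒PfBlocks 0 w (proj₁ (∈pfWords {n} mem))))

SortedBlocks⇒PairsDistinct : ∀ m w → length w ≡ 2 * m → SortedBlocks w → PairsDistinct m w
SortedBlocks⇒PairsDistinct m w lw sw =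
  subst₂ PairsDistinct (length-blocks m w lw) (flat-blocks m w lw) (PairsDistinct-flat (blocks w) (<⇒≢ᴬ sw))

sortBlocks-SortedBlocks : ∀ m w → length w ≡ 2 * m → SortedBlocks w → sortBlocks w ≡ w
sortBlocks-SortedBlocks m w lw sw =
  begin
    sortBlocks w
  ≡⟨ cong sortBlocks (sym (flat-blocks m w lw)) ⟩
    sortBlocks (flat (blocks w))
  ≡⟨ sortBlocks-flat (blocks w) ⟩
    flat (map sortBlock (blocks w))
  ≡⟨ cong flat (map-sortBlock-id (blocks w) sw) ⟩
    flat (blocks w)
  ≡⟨ flat-blocks m w lw ⟩
    w
  ∎
  where open ≡-Reasoning

compose-β-SortedBlocks : ∀ m w π → length w ≡ 2 * m → IsPerm m π → SortedBlocks w →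
  SortedBlocks (compose w (β π))
compose-β-SortedBlocks m w π lw vπ sw =
  subst SortedBlocks (sym (compose-β m w π lw))
    (subst (All (λ z → proj₁ z < proj₂ z)) (sym (blocks-flat _))
      (AllP.map⁺ (All.map (λ {i} p → All.lookup sw (blockAt-∈ (blocks w) i (subst (i <_) (sym (length-blocks m w lw)) p)))
                          (IsPerm.below vπ))))

∑Y-wordEq : ∀ m σ u → length u ≡ 2 * m → PairsDistinct m u →
  ∑ (λ e → 𝟙 (wordEqᵇ (compose u (proj₂ e)) σ)) (Y m) ≡ 𝟙 (wordEqᵇ (sortBlocks u) (sortBlocks σ))
∑Y-wordEq m σ u lu pu = Eq.trans (∑Y-flipSum m (λ x → 𝟙 (wordEqᵇ x σ)) u lu) (flipSum-wordEq m u σ pu)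

-- Among the flips of w, only the one orienting each block as in σ can be block-shuffled into σ.
module _ (m : ℕ) (σ w : Word) (perm-w : IsPerm (2 * m) w) (sorted-w : SortedBlocks w) where
  private
    lw = IsPerm.length≡ perm-w
    dw = IsPerm.distinct perm-w
    pw = SortedBlocks⇒PairsDistinct m w lw sorted-w
    lB = length-blocks m w lw
    fw = flat-blocks m w lw
    x₀ = flat (map (orientAs (blocks σ)) (blocks w))

    isFlip-x₀ : IsFlip m w x₀
    isFlip-x₀ = subst₂ (λ a b → IsFlip a b x₀) lB fw (IsFlip-orientAs (blocks σ) (blocks w))

    flip-length : ∀ x → IsFlip m w x → length x ≡ 2 * m
    flip-length x f = Eq.trans (IsFlip-length m w x f) lw

    flip-distinct : ∀ x → IsFlip m w x → Distinct x
    flip-distinct x f = Distinct-resp-↭ (↭-sym (IsFlip-↭ m w x f)) dw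

    shuffle-flip-unique : ∀ x → IsFlip m w x → isShuffleᵇ m x σ ≡ true → x ≡ x₀
    shuffle-flip-unique x f hit =
      IsFlip-∈⇒orientAs (blocks σ) (blocks w) x dσ (<⇒≢ᴬ sorted-w) (subst₂ (λ a b → IsFlip a b x) (sym lB) (sym fw) f)
        (All.tabulate (PermP.∈-resp-↭ (↭-sym (proj₁ shuffle))))
      where
      shuffle = isShuffleᵇ-sound m x σ hit (flip-length x f)
      σ↭x : σ ↭ x
      σ↭x = subst₂ _↭_ (proj₂ shuffle) (flat-blocks m x (flip-length x f)) (flat-↭ (proj₁ shuffle))
      dσ : Distinct (flat (blocks σ))
      dσ = subst Distinct (sym (proj₂ shuffle)) (Distinct-resp-↭ (↭-sym σ↭x) (flip-distinct x f))

    shuffle-x₀⇒ : isShuffleᵇ m x₀ σ ≡ true → isShuffleᵇ m w (sortBlocks σ) ≡ true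
    shuffle-x₀⇒ hit = isShuffleᵇ-complete m w (sortBlocks σ) blocks↭ flat-blocks-sσ lw dw
      where
      shuffle = isShuffleᵇ-sound m x₀ σ hit (flip-length x₀ isFlip-x₀)
      sσ : sortBlocks σ ≡ flat (map sortBlock (blocks σ))
      sσ = Eq.trans (cong sortBlocks (sym (proj₂ shuffle))) (sortBlocks-flat (blocks σ))
      blocks-sσ : blocks (sortBlocks σ) ≡ map sortBlock (blocks σ)
      blocks-sσ = Eq.trans (cong blocks sσ) (blocks-flat _)
      unorient : map sortBlock (map (orientAs (blocks σ)) (blocks w)) ≡ blocks w
      unorient = Eq.trans (sym (LP.map-∘ (blocks w)))
        (Eq.trans (LP.map-cong-local (All.map (λ {z} p → sortBlock-orientAs (blocks σ) (proj₁ z) (proj₂ z) p) sorted-w))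
                  (LP.map-id (blocks w)))
      blocks↭ : blocks (sortBlocks σ) ↭ blocks w
      blocks↭ = subst₂ _↭_ (sym blocks-sσ) unorient
        (subst (λ z → map sortBlock (blocks σ) ↭ map sortBlock z) (blocks-flat _) (PermP.map⁺ sortBlock (proj₁ shuffle)))
      flat-blocks-sσ : flat (blocks (sortBlocks σ)) ≡ sortBlocks σ
      flat-blocks-sσ = Eq.trans (cong flat blocks-sσ) (sym sσ)

    shuffle-x₀⇐ : isShuffleᵇ m w (sortBlocks σ) ≡ true → isShuffleᵇ m x₀ σ ≡ true
    shuffle-x₀⇐ hit = isShuffleᵇ-complete m x₀ σ blocks↭ fσ (flip-length x₀ isFlip-x₀) (flip-distinct x₀ isFlip-x₀)
      where
      shuffle = isShuffleᵇ-sound m w (sortBlocks σ) hit lw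
      lσ : length σ ≡ 2 * length (blocks (sortBlocks σ))
      lσ = Eq.trans (sym (PermP.↭-length (sortBlocks-↭ σ)))
                    (Eq.trans (cong length (sym (proj₂ shuffle))) (length-flat (blocks (sortBlocks σ))))
      fσ : flat (blocks σ) ≡ σ
      fσ = flat-blocks (length (blocks (sortBlocks σ))) σ lσ
      blocks-sσ : blocks (sortBlocks σ) ≡ map sortBlock (blocks σ)
      blocks-sσ = Eq.trans (cong (λ z → blocks (sortBlocks z)) (sym fσ))
                           (Eq.trans (cong blocks (sortBlocks-flat (blocks σ))) (blocks-flat _))
      σ↭w : σ ↭ w
      σ↭w = trans (↭-sym (sortBlocks-↭ σ)) (subst₂ _↭_ (proj₂ shuffle) fw (flat-↭ (proj₁ shuffle)))
      dσ : Distinct (flat (blocks σ))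
      dσ = subst Distinct (sym fσ) (Distinct-resp-↭ (↭-sym σ↭w) dw)
      reorient : map (orientAs (blocks σ)) (map sortBlock (blocks σ)) ≡ blocks σ
      reorient = Eq.trans (sym (LP.map-∘ (blocks σ)))
        (Eq.trans (LP.map-cong-local (All.tabulate (λ {z} zm →
                     orientAs-sortBlock (blocks σ) z dσ zm (All.lookup (Distinct-blocks-≢ (blocks σ) dσ) zm))))
                  (LP.map-id (blocks σ)))
      blocks↭ : blocks σ ↭ blocks x₀
      blocks↭ = subst₂ _↭_ reorient (sym (blocks-flat _))
        (PermP.map⁺ (orientAs (blocks σ)) (subst (_↭ blocks w) blocks-sσ (proj₁ shuffle)))

  ∑YΘ-isShuffle : ∑ (λ e → ∑ (λ π → 𝟙 (wordEqᵇ (compose (compose w (proj₂ e)) (β π)) σ)) (perms m)) (Y m)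
                  ≡ 𝟙 (isShuffleᵇ m w (sortBlocks σ))
  ∑YΘ-isShuffle =
    begin
      ∑ (λ e → shuffles (compose w (proj₂ e))) (Y m)
    ≡⟨ ∑Y-flipSum m shuffles w lw ⟩
      flipSum m shuffles w
    ≡⟨ flipSum-pointMass m shuffles w x₀ _ pw only-x₀ ⟩
      𝟙 (wordEqᵇ (sortBlocks w) (sortBlocks x₀)) * 𝟙 (isShuffleᵇ m x₀ σ)
    ≡⟨ cong (λ z → 𝟙 (wordEqᵇ (sortBlocks w) z) * 𝟙 (isShuffleᵇ m x₀ σ)) (IsFlip-sortBlocks m w x₀ pw isFlip-x₀) ⟩
      𝟙 (wordEqᵇ (sortBlocks w) (sortBlocks w)) * 𝟙 (isShuffleᵇ m x₀ σ)
    ≡⟨ cong (λ b → 𝟙 b * 𝟙 (isShuffleᵇ m x₀ σ)) (wordEqᵇ-refl (sortBlocks w)) ⟩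
      1 * 𝟙 (isShuffleᵇ m x₀ σ)
    ≡⟨ NP.*-identityˡ _ ⟩
      𝟙 (isShuffleᵇ m x₀ σ)
    ≡⟨ cong 𝟙 (Bool-ext shuffle-x₀⇒ shuffle-x₀⇐) ⟩
      𝟙 (isShuffleᵇ m w (sortBlocks σ))
    ∎
    where
    open ≡-Reasoning
    shuffles : Word → ℕ
    shuffles x = ∑ (λ π → 𝟙 (wordEqᵇ (compose x (β π)) σ)) (perms m)
    only-x₀ : ∀ x → IsFlip m w x → shuffles x ≡ 𝟙 (wordEqᵇ x x₀) * 𝟙 (isShuffleᵇ m x₀ σ)
    only-x₀ x f = Eq.trans (∑Θ-shuffle m x σ (flip-length x f) (flip-distinct x f))
                           (𝟙-unique (λ x → isShuffleᵇ m x σ) x x₀ (shuffle-flip-unique x f))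

-- Coefficients as signed multiplicities

multiplicity : Word → Elem → ℕ
multiplicity σ x = ∑ (λ e → 𝟙 (wordEqᵇ (proj₂ e) σ)) x

infixl 7 _×ℚ_
_×ℚ_ : ℕ → ℚ → ℚ
zero ×ℚ q = 0ℚ
suc k ×ℚ q = q Q.+ k ×ℚ q

SignedEntry : ℚ × Word → Set
SignedEntry e = proj₁ e ≡ sgn (proj₂ e)

coeff-signed : ∀ x σ → All SignedEntry x → coeff x σ ≡ multiplicity σ x ×ℚ sgn σ
coeff-signed [] σ _ = refl
coeff-signed ((c , v) ∷ x) σ (h ∷ hs) with wordEqᵇ v σ in e
... | true = cong₂ Q._+_ (Eq.trans h (cong sgn (wordEqᵇ-sound v σ e))) (coeff-signed x σ hs)
... | false = Eq.trans (QP.+-identityˡ (coeff x σ)) (coeff-signed x σ hs)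

≈-byMultiplicity : ∀ x y → All SignedEntry x → All SignedEntry y →
  (∀ σ → multiplicity σ x ≡ multiplicity σ y) → x ≈ y
≈-byMultiplicity x y sx sy h σ =
  Eq.trans (coeff-signed x σ sx) (Eq.trans (cong (_×ℚ sgn σ) (h σ)) (sym (coeff-signed y σ sy)))

SignedPerm : ℕ → ℚ × Word → Set
SignedPerm n e = SignedEntry e × length (proj₂ e) ≡ n × Distinct (proj₂ e)

Pf-SignedPerm : ∀ m → All (SignedPerm (2 * m)) (Pf (2 * m))
Pf-SignedPerm m = AllP.map⁺ (All.tabulate (λ {w} mem →
  let perm-w = ∈pfWords⇒IsPerm {2 * m} mem in refl , IsPerm.length≡ perm-w , IsPerm.distinct perm-w))

·Θ-SignedPerm : ∀ m x → All (SignedPerm (2 * m)) x → All (SignedPerm (2 * m)) (x · Θ m)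
·Θ-SignedPerm m x hx = All-· x (Θ m)
  (All.map (λ {a} (ha , la , da) → AllP.map⁺ (All.tabulate (λ {π} mem →
     let vπ = ∈perms⇒IsPerm mem
         p = compose-β-↭ m (proj₂ a) π la vπ in
       Eq.trans (QP.*-identityʳ (proj₁ a)) (Eq.trans ha (sym (sgn-compose-β m (proj₂ a) π la da vπ))) ,
       Eq.trans (PermP.↭-length p) la ,
       Distinct-resp-↭ (↭-sym p) da)))
   hx)

·Y-SignedPerm : ∀ m x → All (SignedPerm (2 * m)) x → All (SignedPerm (2 * m)) (x · Y m)
·Y-SignedPerm m x hx = All-· x (Y m)
  (All.map (λ {a} (ha , la , da) → All.map (λ {b} (hs , hp) →
     let p = hp (proj₂ a) la in
       Eq.trans (cong (Q._* proj₁ b) ha) (Eq.trans (QP.*-comm (sgn (proj₂ a)) (proj₁ b)) (sym (hs (proj₂ a) la da))) ,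
       Eq.trans (PermP.↭-length p) la ,
       Distinct-resp-↭ (↭-sym p) da)
     (All.zip (Y-signCompatible m , Y-↭ m)))
   hx)

signedSum-signed : ∀ n → All SignedEntry (signedSum n)
signedSum-signed n = AllP.map⁺ (All.tabulate (λ _ → refl))

multiplicity-signedSum : ∀ n σ → multiplicity σ (signedSum n) ≡ 𝟙 (isPermᵇ n σ)
multiplicity-signedSum n σ = Eq.trans (∑-map (λ e → 𝟙 (wordEqᵇ (proj₂ e) σ)) _ (perms n)) (count-perms n σ)

multiplicity-PfΘY : ∀ m σ → multiplicity σ (Pf (2 * m) · Θ m · Y m) ≡ 𝟙 (isPermᵇ (2 * m) σ)
multiplicity-PfΘY m σ =
  begin
    multiplicity σ (Pf (2 * m) · Θ m · Y m)
  ≡⟨ ∑-· (λ e → 𝟙 (wordEqᵇ (proj₂ e) σ)) (Pf (2 * m) · Θ m) (Y m) ⟩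
    ∑ (λ a → hitsY (proj₂ a)) (Pf (2 * m) · Θ m)
  ≡⟨ ∑-· (λ e → hitsY (proj₂ e)) (Pf (2 * m)) (Θ m) ⟩
    ∑ (λ a → ∑ (λ c → hitsY (compose (proj₂ a) (proj₂ c))) (Θ m)) (Pf (2 * m))
  ≡⟨ ∑-map (λ a → ∑ (λ c → hitsY (compose (proj₂ a) (proj₂ c))) (Θ m)) _ (pfWords (2 * m)) ⟩
    ∑ (λ w → ∑ (λ c → hitsY (compose w (proj₂ c))) (Θ m)) (pfWords (2 * m))
  ≡⟨ ∑-cong (pfWords (2 * m)) (λ w → ∑-map (λ c → hitsY (compose w (proj₂ c))) _ (perms m)) ⟩
    ∑ (λ w → ∑ (λ π → hitsY (compose w (β π))) (perms m)) (pfWords (2 * m))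
  ≡⟨ ∑-congᴬ (All.tabulate (λ {w} mem → Eq.trans (∑-congᴬ (All.tabulate (hitsY-shuffle mem)))
                                           (∑Θ-shuffle m w (sortBlocks σ) (length-w mem) (distinct-w mem)))) ⟩
    ∑ (λ w → 𝟙 (isShuffleᵇ m w (sortBlocks σ))) (pfWords (2 * m))
  ≡⟨ ∑pfWords-isShuffle m σ ⟩
    𝟙 (isPermᵇ (2 * m) σ)
  ∎
  where
  open ≡-Reasoning
  hitsY : Word → ℕ
  hitsY u = ∑ (λ b → 𝟙 (wordEqᵇ (compose u (proj₂ b)) σ)) (Y m)
  length-w : ∀ {w} → w ∈ pfWords (2 * m) → length w ≡ 2 * m
  length-w mem = IsPerm.length≡ (∈pfWords⇒IsPerm {2 * m} mem)
  distinct-w : ∀ {w} → w ∈ pfWords (2 * m) → Distinct w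
  distinct-w mem = IsPerm.distinct (∈pfWords⇒IsPerm {2 * m} mem)
  hitsY-shuffle : ∀ {w π} → w ∈ pfWords (2 * m) → π ∈ perms m →
    hitsY (compose w (β π)) ≡ 𝟙 (wordEqᵇ (compose w (β π)) (sortBlocks σ))
  hitsY-shuffle {w} {π} mem memπ =
    Eq.trans (∑Y-wordEq m σ u lu (SortedBlocks⇒PairsDistinct m u lu su))
             (cong (λ z → 𝟙 (wordEqᵇ z (sortBlocks σ))) (sortBlocks-SortedBlocks m u lu su))
    where
    u = compose w (β π)
    lu = Eq.trans (PermP.↭-length (compose-β-↭ m w π (length-w mem) (∈perms⇒IsPerm memπ))) (length-w mem)
    su = compose-β-SortedBlocks m w π (length-w mem) (∈perms⇒IsPerm memπ) (∈pfWords⇒SortedBlocks {2 * m} mem)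

multiplicity-PfYΘ : ∀ m σ → multiplicity σ (Pf (2 * m) · Y m · Θ m) ≡ 𝟙 (isPermᵇ (2 * m) σ)
multiplicity-PfYΘ m σ =
  begin
    multiplicity σ (Pf (2 * m) · Y m · Θ m)
  ≡⟨ ∑-· (λ e → 𝟙 (wordEqᵇ (proj₂ e) σ)) (Pf (2 * m) · Y m) (Θ m) ⟩
    ∑ (λ a → hitsΘ (proj₂ a)) (Pf (2 * m) · Y m)
  ≡⟨ ∑-· (λ e → hitsΘ (proj₂ e)) (Pf (2 * m)) (Y m) ⟩
    ∑ (λ a → ∑ (λ b → hitsΘ (compose (proj₂ a) (proj₂ b))) (Y m)) (Pf (2 * m))
  ≡⟨ ∑-map (λ a → ∑ (λ b → hitsΘ (compose (proj₂ a) (proj₂ b))) (Y m)) _ (pfWords (2 * m)) ⟩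
    ∑ (λ w → ∑ (λ b → hitsΘ (compose w (proj₂ b))) (Y m)) (pfWords (2 * m))
  ≡⟨ ∑-cong (pfWords (2 * m)) (λ w → ∑-cong (Y m) (λ b →
       ∑-map (λ c → 𝟙 (wordEqᵇ (compose (compose w (proj₂ b)) (proj₂ c)) σ)) _ (perms m))) ⟩
    ∑ (λ w → ∑ (λ b → ∑ (λ π → 𝟙 (wordEqᵇ (compose (compose w (proj₂ b)) (β π)) σ)) (perms m)) (Y m)) (pfWords (2 * m))
  ≡⟨ ∑-congᴬ (All.tabulate (λ {w} mem →
       ∑YΘ-isShuffle m σ w (∈pfWords⇒IsPerm {2 * m} mem) (∈pfWords⇒SortedBlocks {2 * m} mem))) ⟩
    ∑ (λ w → 𝟙 (isShuffleᵇ m w (sortBlocks σ))) (pfWords (2 * m))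
  ≡⟨ ∑pfWords-isShuffle m σ ⟩
    𝟙 (isPermᵇ (2 * m) σ)
  ∎
  where
  open ≡-Reasoning
  hitsΘ : Word → ℕ
  hitsΘ x = ∑ (λ c → 𝟙 (wordEqᵇ (compose x (proj₂ c)) σ)) (Θ m)

proposition4 : (m : ℕ) →
    (signedSum (2 * m) ≈ Pf (2 * m) · Θ m · Y m)
    × (signedSum (2 * m) ≈ Pf (2 * m) · Y m · Θ m)
proposition4 m =
  ≈-byMultiplicity _ _ (signedSum-signed (2 * m)) (All.map proj₁ PfΘY-signed)
    (λ σ → Eq.trans (multiplicity-signedSum (2 * m) σ) (sym (multiplicity-PfΘY m σ))) ,
  ≈-byMultiplicity _ _ (signedSum-signed (2 * m)) (All.map proj₁ PfYΘ-signed)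
    (λ σ → Eq.trans (multiplicity-signedSum (2 * m) σ) (sym (multiplicity-PfYΘ m σ)))
  where
  PfΘY-signed = ·Y-SignedPerm m _ (·Θ-SignedPerm m _ (Pf-SignedPerm m))
  PfYΘ-signed = ·Θ-SignedPerm m _ (·Y-SignedPerm m _ (Pf-SignedPerm m))
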